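{- Let $\mathfrak{M}$ be a listable $\mathscr{L}$-structure with domain $M$. Suppose there are finitely many elements $g_0,g_1,\dots,g_c\in M$ and functions $F_1,\dots,F_k:M^r\to M$ such that each $g_j$ and each $F_i$ is p.e. $\mathscr{L}$-definable over $\mathfrak{M}$, and $M$ is generated by the $g_j$ and the $F_i$, in the sense that every element of $M$ is obtained by applying a suitable composition of the $F_i$ to the elements $g_j$. Then $\mathfrak{M}$ is uniquely listable.
   Context: All languages contain $=$, interpreted as equality. Listable means recursively enumerable. A listable presentation of $\mathfrak{M}$ is a surjection $\rho:\mathbb{N}\to M$ such that for every symbol $s\in\mathscr{L}$ the preimage of its interpretation (graph, for function symbols) under the coordinatewise map induced by $\rho$ is listable; $\mathfrak{M}$ is listable if one exists. Presentations $\rho,\gamma$ are equivalent if $\gamma=\rho\circ\phi$ for a total recursive $\phi:\mathbb{N}\to\mathbb{N}$; uniquely listable means all listable presentations are equivalent. P.e. (positive existential) formulas use only atomic formulas, $\wedge,\vee,\exists$, without parameters; an element is p.e. definable if the singleton is, and a function is p.e. definable if its graph is. -}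

module Defs where

open import Data.Nat using (ℕ; zero; suc; _<_)
open import Data.Fin using (Fin)
open import Data.Vec using (Vec; []; _∷_; map; lookup; _∷ʳ_)
open import Data.Vec.Relation.Unary.All using (All)
open import Data.Product using (Σ; ∃; _×_; _,_)
open import Data.Sum using (_⊎_)
open import Function.Bundles using (_⇔_)
open import Relation.Binary.PropositionalEquality using (_≡_)

data Rec : ℕ → Set where
  zer  : ∀ {n} → Rec n
  succ : Rec 1
  proj : ∀ {n} → Fin n → Rec n
  comp : ∀ {m n} → Rec m → Vec (Rec n) m → Rec n
  prec : ∀ {n} → Rec n → Rec (suc (suc n)) → Rec (suc n)
  mu   : ∀ {n} → Rec (suc n) → Rec n

mutual
  data Eval : ∀ {n} → Rec n → Vec ℕ n → ℕ → Set where
    ev-zer  : ∀ {n} {xs : Vec ℕ n} → Eval zer xs 0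
    ev-succ : ∀ {x} → Eval succ (x ∷ []) (suc x)
    ev-proj : ∀ {n} {i : Fin n} {xs} → Eval (proj i) xs (lookup xs i)
    ev-comp : ∀ {m n} {f : Rec m} {gs : Vec (Rec n) m} {xs zs y} →
              EvalVec gs xs zs → Eval f zs y → Eval (comp f gs) xs y
    ev-prec0 : ∀ {n} {g : Rec n} {h} {xs y} →
               Eval g xs y → Eval (prec g h) (0 ∷ xs) y
    ev-precS : ∀ {n} {g : Rec n} {h} {k xs z y} →
               Eval (prec g h) (k ∷ xs) z → Eval h (k ∷ z ∷ xs) y →
               Eval (prec g h) (suc k ∷ xs) y
    ev-mu   : ∀ {n} {f : Rec (suc n)} {xs y} →
              Eval f (y ∷ xs) 0 →
              (∀ z → z < y → ∃ λ v → Eval f (z ∷ xs) (suc v)) →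
              Eval (mu f) xs y

  data EvalVec {n} : ∀ {m} → Vec (Rec n) m → Vec ℕ n → Vec ℕ m → Set where
    []  : ∀ {xs} → EvalVec [] xs []
    _∷_ : ∀ {m} {g} {gs : Vec (Rec n) m} {xs z zs} →
          Eval g xs z → EvalVec gs xs zs → EvalVec (g ∷ gs) xs (z ∷ zs)

Listable : ∀ {n} → (Vec ℕ n → Set) → Set
Listable {n} A = Σ (Rec n) λ f → ∀ xs → A xs ⇔ (∃ λ y → Eval f xs y)

TotalRecursive : (ℕ → ℕ) → Set
TotalRecursive φ = Σ (Rec 1) λ f → ∀ x → Eval f (x ∷ []) (φ x)

-- First-order languages and structures (equality is always interpreted
-- as propositional equality on the carrier).

record Language : Set₁ where
  field
    RelSym   : Set
    relArity : RelSym → ℕ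
    FunSym   : Set          -- constants are 0-ary function symbols
    funArity : FunSym → ℕ

record Structure (L : Language) : Set₁ where
  open Language L
  field
    Carrier : Set
    relI    : (R : RelSym) → Vec Carrier (relArity R) → Set
    funI    : (f : FunSym) → Vec Carrier (funArity f) → Carrier

-- graph of F : Aʳ → A as the set of tuples (x₁,…,x_r, F x)
GraphOf : ∀ {A : Set} {r} → (Vec A r → A) → Vec A (suc r) → Set
GraphOf {r = zero} F (y ∷ []) = F [] ≡ y
GraphOf {r = suc r} F (x ∷ vs) = GraphOf (λ xs → F (x ∷ xs)) vs

module _ {L : Language} (𝔐 : Structure L) where
  open Language L
  open Structure 𝔐

  funGraph : (f : FunSym) → Vec Carrier (suc (funArity f)) → Set
  funGraph f vs = GraphOf (funI f) vs

  record IsListablePresentation (ρ : ℕ → Carrier) : Set where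
    field
      surjective : ∀ m → ∃ λ n → ρ n ≡ m
      eqListable : Listable {2} λ { (a ∷ b ∷ []) → ρ a ≡ ρ b }
      relListable : ∀ R → Listable {relArity R} λ ns → relI R (map ρ ns)
      funListable : ∀ f → Listable {suc (funArity f)}
                      λ ns → funGraph f (map ρ ns)
  IsListable : Set
  IsListable = Σ (ℕ → Carrier) IsListablePresentation

  Equivalent : (ρ γ : ℕ → Carrier) → Set
  Equivalent ρ γ = Σ (ℕ → ℕ) λ φ → TotalRecursive φ × (∀ n → γ n ≡ ρ (φ n))

  UniquelyListable : Set
  UniquelyListable = ∀ ρ γ → IsListablePresentation ρ →
                     IsListablePresentation γ → Equivalent ρ γ

  -- Positive existential formulas (de Bruijn variables, no parameters).

  data Term (n : ℕ) : Set where
    var : Fin n → Term n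
    app : (f : FunSym) → Vec (Term n) (funArity f) → Term n

  mutual
    evalT : ∀ {n} → Vec Carrier n → Term n → Carrier
    evalT ρ (var i) = lookup ρ i
    evalT ρ (app f ts) = funI f (evalTs ρ ts)

    evalTs : ∀ {n m} → Vec Carrier n → Vec (Term n) m → Vec Carrier m
    evalTs ρ [] = []
    evalTs ρ (t ∷ ts) = evalT ρ t ∷ evalTs ρ ts

  data PEFormula (n : ℕ) : Set where
    _≐_  : Term n → Term n → PEFormula n
    rel  : (R : RelSym) → Vec (Term n) (relArity R) → PEFormula n
    _∧'_ : PEFormula n → PEFormula n → PEFormula n
    _∨'_ : PEFormula n → PEFormula n → PEFormula n
    ∃'   : PEFormula (suc n) → PEFormula n

  -- satisfaction; variable 0 of an ∃-body is the newly bound variable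
  Sat : ∀ {n} → PEFormula n → Vec Carrier n → Set
  Sat (s ≐ t) v = evalT v s ≡ evalT v t
  Sat (rel R ts) v = relI R (evalTs v ts)
  Sat (φ ∧' ψ) v = Sat φ v × Sat ψ v
  Sat (φ ∨' ψ) v = Sat φ v ⊎ Sat ψ v
  Sat (∃' φ) v = ∃ λ x → Sat φ (x ∷ v)

  PEDefinableSet : ∀ {n} → (Vec Carrier n → Set) → Set
  PEDefinableSet {n} A = Σ (PEFormula n) λ φ → ∀ v → Sat φ v ⇔ A v

  PEDefinableElement : Carrier → Set
  PEDefinableElement g = PEDefinableSet {1} λ { (x ∷ []) → x ≡ g }

  PEDefinableFunction : ∀ {r} → (Vec Carrier r → Carrier) → Set
  PEDefinableFunction F = PEDefinableSet (GraphOf F)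

  data Generated {c k r : ℕ} (g : Fin c → Carrier)
                 (F : Fin k → Vec Carrier r → Carrier) : Carrier → Set where
    gen-base : ∀ j → Generated g F (g j)
    gen-app  : ∀ i (xs : Vec Carrier r) → All (Generated g F) xs →
               Generated g F (F i xs)

-- Fix two listable presentations ρ and γ. Since ρ is onto, it suffices that the matching relation
-- ρ a = γ b be listable: a search through it then computes, for each n, some φ n with ρ (φ n) = γ n.
-- Listable presentations pull p.e. definable sets back to listable sets, so the graphs of the Fᵢ are
-- listable when read through ρ and when read through γ. Call (a , b) derivable if it is a pair of indices
-- of a generator, or if it follows from derivable pairs (aᵢ , bᵢ) by the graph of some Fᵢ, read through ρ
-- on the left and through γ on the right. Derivable pairs match, and since M is generated every element
-- has a derivable pair of indices; so ρ a = γ b iff ρ a = ρ a' and γ b' = γ b for some derivable (a' , b').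
-- Derivability is listable: the pairs derivable in d rounds with indices and semidecision stages bounded
-- by t form a finite table, computable by primitive recursion as the binary digits of a number, and a pair
-- is derivable iff it occurs in one of these tables.

module Submission where

open import Defs
open import Data.Empty using (⊥-elim)
open import Data.Fin using (Fin; zero; suc)
open import Data.Nat using (ℕ; zero; suc; _+_; _*_; _∸_; _^_; _≤_; _<_; z≤n; s≤s; pred; _⊔_)
open import Data.Nat.Properties
open import Data.Nat.Tactic.RingSolver using (solve-∀)
open import Data.Product using (Σ; ∃; _×_; _,_; proj₁; proj₂)
open import Data.Sum using (_⊎_; inj₁; inj₂)
open import Data.Vec using (Vec; []; _∷_; map; lookup; _∷ʳ_; head; tail; tabulate; _++_; take; drop; zipWith)
open import Data.Vec.Properties using (tabulate∘lookup; lookup-map; map-∷ʳ; ∷-injectiveˡ; ∷-injectiveʳ)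
open import Data.Vec.Relation.Unary.All using (All; []; _∷_)
open import Data.Vec.Relation.Binary.Pointwise.Inductive as Pointwise using (Pointwise; []; _∷_)
open import Function.Bundles using (Equivalence)
open import Relation.Binary.PropositionalEquality

-- Computable functions

Fun : ℕ → Set
Fun n = Vec ℕ n → ℕ

Computable : ∀ {n} → Fun n → Set
Computable {n} F = Σ (Rec n) λ e → ∀ xs → Eval e xs (F xs)

Computables : ∀ {n m} → (Vec ℕ n → Vec ℕ m) → Set
Computables {n} {m} G = Σ (Vec (Rec n) m) λ es → ∀ xs → EvalVec es xs (G xs)

infixr 5 _∷ᶜ_
infix 4 _∘ᶜ_
infixr 9 _∘ˢ_

computable-ext : ∀ {n} {F G : Fun n} → Computable F → (∀ xs → F xs ≡ G xs) → Computable G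
computable-ext (e , ok) F≗G = e , λ xs → subst (Eval e xs) (F≗G xs) (ok xs)

computables-ext : ∀ {n m} {F G : Vec ℕ n → Vec ℕ m} →
                  Computables F → (∀ xs → F xs ≡ G xs) → Computables G
computables-ext (es , ok) F≗G = es , λ xs → subst (EvalVec es xs) (F≗G xs) (ok xs)

zeroᶜ : ∀ {n} → Computable {n} (λ _ → 0)
zeroᶜ = zer , λ _ → ev-zer

sucᶜ : Computable {1} (λ v → suc (head v))
sucᶜ = succ , λ { (_ ∷ []) → ev-succ }

projᶜ : ∀ {n} (i : Fin n) → Computable (λ xs → lookup xs i)
projᶜ i = proj i , λ _ → ev-proj

[]ᶜ : ∀ {n} → Computables {n} (λ _ → [])
[]ᶜ = [] , λ _ → []

_∷ᶜ_ : ∀ {n m} {F : Fun n} {G : Vec ℕ n → Vec ℕ m} →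
       Computable F → Computables G → Computables (λ xs → F xs ∷ G xs)
(e , ok) ∷ᶜ (es , oks) = (e ∷ es) , λ xs → ok xs ∷ oks xs

_∘ᶜ_ : ∀ {n m} {F : Fun m} {G : Vec ℕ n → Vec ℕ m} →
       Computable F → Computables G → Computable (λ xs → F (G xs))
(e , ok) ∘ᶜ (es , oks) = comp e es , λ xs → ev-comp (oks xs) (ok _)

_∘ˢ_ : ∀ {n m p} {F : Vec ℕ m → Vec ℕ p} {G : Vec ℕ n → Vec ℕ m} →
       Computables F → Computables G → Computables (λ xs → F (G xs))
_∘ˢ_ {p = zero} {F} _ _ = computables-ext []ᶜ (λ xs → sym (vec0 (F _)))
  where vec0 : (v : Vec ℕ 0) → v ≡ []
        vec0 [] = refl
_∘ˢ_ {p = suc p} {F} (e ∷ es , ok) Gᶜ =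
  computables-ext (((e , λ xs → head-eval (ok xs)) ∘ᶜ Gᶜ) ∷ᶜ ((es , λ xs → tail-eval (ok xs)) ∘ˢ Gᶜ))
                  (λ xs → head∷tail (F _))
  where
    head-eval : ∀ {n m} {e : Rec n} {es : Vec (Rec n) m} {xs zs} →
                EvalVec (e ∷ es) xs zs → Eval e xs (head zs)
    head-eval (ev ∷ _) = ev
    tail-eval : ∀ {n m} {e : Rec n} {es : Vec (Rec n) m} {xs zs} →
                EvalVec (e ∷ es) xs zs → EvalVec es xs (tail zs)
    tail-eval (_ ∷ evs) = evs
    head∷tail : ∀ {q} (v : Vec ℕ (suc q)) → head v ∷ tail v ≡ v
    head∷tail (_ ∷ _) = refl

tabulateᶜ : ∀ {n p} (f : Fin n → Fin p) → Computables (λ xs → tabulate (λ i → lookup xs (f i)))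
tabulateᶜ {zero} f = []ᶜ
tabulateᶜ {suc n} f = projᶜ (f zero) ∷ᶜ tabulateᶜ (λ i → f (suc i))

idˢ : ∀ {n} → Computables {n} (λ xs → xs)
idˢ = computables-ext (tabulateᶜ (λ i → i)) tabulate∘lookup

tailˢ : ∀ {n} → Computables {suc n} tail
tailˢ = computables-ext (tabulateᶜ suc) (λ { (_ ∷ xs) → tabulate∘lookup xs })

headᶜ : ∀ {n} → Computable {suc n} head
headᶜ = computable-ext (projᶜ zero) (λ { (_ ∷ _) → refl })

secondᶜ : ∀ {n} → Computable {suc (suc n)} (λ v → head (tail v))
secondᶜ = computable-ext (projᶜ (suc zero)) (λ { (_ ∷ _ ∷ _) → refl })

thirdᶜ : ∀ {n} → Computable {suc (suc (suc n))} (λ v → head (tail (tail v)))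
thirdᶜ = computable-ext (projᶜ (suc (suc zero))) (λ { (_ ∷ _ ∷ _ ∷ _) → refl })

primRec : ∀ {n} → Fun n → Fun (suc (suc n)) → Fun (suc n)
primRec g h (zero ∷ xs) = g xs
primRec g h (suc k ∷ xs) = h (k ∷ primRec g h (k ∷ xs) ∷ xs)

primRecᶜ : ∀ {n} {g : Fun n} {h : Fun (suc (suc n))} → Computable g → Computable h →
           Computable (primRec g h)
primRecᶜ {g = g} {h} (eg , okg) (eh , okh) = prec eg eh , ok
  where ok : ∀ xs → Eval (prec eg eh) xs (primRec g h xs)
        ok (zero ∷ xs) = ev-prec0 (okg xs)
        ok (suc k ∷ xs) = ev-precS (ok (k ∷ xs)) (okh _)

recursionᶜ : ∀ {n} {g : Fun n} {h : Fun (suc (suc n))} (F : Fun (suc n)) →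
             Computable g → Computable h →
             (∀ xs → F (0 ∷ xs) ≡ g xs) →
             (∀ k xs → F (suc k ∷ xs) ≡ h (k ∷ F (k ∷ xs) ∷ xs)) → Computable F
recursionᶜ {g = g} {h} F gᶜ hᶜ F0 FS = computable-ext (primRecᶜ gᶜ hᶜ) agree
  where agree : ∀ xs → primRec g h xs ≡ F xs
        agree (zero ∷ xs) = sym (F0 xs)
        agree (suc k ∷ xs) = trans (cong (λ z → h (k ∷ z ∷ xs)) (agree (k ∷ xs))) (sym (FS k xs))

constᶜ : ∀ {n} k → Computable {n} (λ _ → k)
constᶜ zero = zeroᶜ
constᶜ (suc k) = sucᶜ ∘ᶜ constᶜ k ∷ᶜ []ᶜ

+ᶜ : Computable {2} (λ v → head v + head (tail v))
+ᶜ = recursionᶜ _ (projᶜ zero) (sucᶜ ∘ᶜ projᶜ (suc zero) ∷ᶜ []ᶜ)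
       (λ { (_ ∷ []) → refl }) (λ { _ (_ ∷ []) → refl })

*ᶜ : Computable {2} (λ v → head v * head (tail v))
*ᶜ = recursionᶜ _ zeroᶜ (+ᶜ ∘ᶜ projᶜ (suc (suc zero)) ∷ᶜ projᶜ (suc zero) ∷ᶜ []ᶜ)
       (λ { (_ ∷ []) → refl }) (λ { _ (_ ∷ []) → refl })

predᶜ : Computable {1} (λ v → pred (head v))
predᶜ = recursionᶜ _ zeroᶜ (projᶜ zero) (λ { [] → refl }) (λ { _ [] → refl })

∸ᶜ : Computable {2} (λ v → head v ∸ head (tail v))
∸ᶜ = flipped ∘ᶜ secondᶜ ∷ᶜ headᶜ ∷ᶜ []ᶜ
  where
    flipped : Computable {2} (λ v → head (tail v) ∸ head v)
    flipped = recursionᶜ _ (projᶜ zero) (predᶜ ∘ᶜ projᶜ (suc zero) ∷ᶜ []ᶜ)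
                (λ { (_ ∷ []) → refl }) (λ { k (x ∷ []) → sym (pred[m∸n]≡m∸[1+n] x k) })

ifZero : ℕ → ℕ → ℕ → ℕ
ifZero zero a b = a
ifZero (suc _) a b = b

ifZeroᶜ : Computable {3} (λ v → ifZero (head v) (head (tail v)) (head (tail (tail v))))
ifZeroᶜ = recursionᶜ _ (projᶜ zero) (projᶜ (suc (suc (suc zero))))
            (λ { (_ ∷ _ ∷ []) → refl }) (λ { _ (_ ∷ _ ∷ []) → refl })

sgn : ℕ → ℕ
sgn zero = 0
sgn (suc _) = 1

sgnᶜ : Computable {1} (λ v → sgn (head v))
sgnᶜ = computable-ext (ifZeroᶜ ∘ᶜ headᶜ ∷ᶜ constᶜ 0 ∷ᶜ constᶜ 1 ∷ᶜ []ᶜ)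
         (λ { (zero ∷ []) → refl ; (suc _ ∷ []) → refl })

allPositive : ∀ {m} → Vec ℕ m → ℕ
allPositive [] = 1
allPositive (x ∷ v) = sgn x * allPositive v

allPositiveᶜ : ∀ {m} → Computable {m} allPositive
allPositiveᶜ {zero} = computable-ext (constᶜ 1) (λ { [] → refl })
allPositiveᶜ {suc m} = computable-ext (*ᶜ ∘ᶜ (sgnᶜ ∘ᶜ headᶜ ∷ᶜ []ᶜ) ∷ᶜ (allPositiveᶜ ∘ᶜ tailˢ) ∷ᶜ []ᶜ)
                                      (λ { (_ ∷ _) → refl })

map-predˢ : ∀ {m} → Computables {m} (map pred)
map-predˢ {zero} = computables-ext []ᶜ (λ { [] → refl })
map-predˢ {suc m} = computables-ext ((predᶜ ∘ᶜ headᶜ ∷ᶜ []ᶜ) ∷ᶜ (map-predˢ ∘ˢ tailˢ)) (λ { (_ ∷ _) → refl })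

takeˢ : ∀ a {n} → Computables {a + n} (take a)
takeˢ zero = computables-ext []ᶜ (λ _ → refl)
takeˢ (suc a) = computables-ext (headᶜ ∷ᶜ (takeˢ a ∘ˢ tailˢ)) (λ { (_ ∷ _) → refl })

dropˢ : ∀ a {n} → Computables {a + n} (drop a)
dropˢ zero = idˢ
dropˢ (suc a) = computables-ext (dropˢ a ∘ˢ tailˢ) (λ { (_ ∷ _) → refl })

∷ʳˢ : ∀ {p m} {G : Vec ℕ p → Vec ℕ m} {F : Fun p} → Computables G → Computable F →
      Computables (λ v → G v ∷ʳ F v)
∷ʳˢ {m = zero} {G} Gᶜ Fᶜ = computables-ext (Fᶜ ∷ᶜ []ᶜ) (λ v → empty-∷ʳ (G v))
  where empty-∷ʳ : ∀ (w : Vec ℕ 0) {y} → y ∷ [] ≡ w ∷ʳ y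
        empty-∷ʳ [] = refl
∷ʳˢ {m = suc m} {G} Gᶜ Fᶜ =
  computables-ext ((headᶜ ∘ᶜ Gᶜ) ∷ᶜ ∷ʳˢ {G = λ v → tail (G v)} (tailˢ ∘ˢ Gᶜ) Fᶜ) (λ v → unfold-∷ʳ (G v))
  where unfold-∷ʳ : ∀ (w : Vec ℕ (suc m)) {y} → head w ∷ (tail w ∷ʳ y) ≡ w ∷ʳ y
        unfold-∷ʳ (_ ∷ _) = refl

++ˢ : ∀ {p m n} {G : Vec ℕ p → Vec ℕ m} {H : Vec ℕ p → Vec ℕ n} → Computables G → Computables H →
      Computables (λ v → G v ++ H v)
++ˢ {m = zero} {G = G} Gᶜ Hᶜ = computables-ext Hᶜ (λ v → empty-++ (G v))
  where empty-++ : ∀ (w : Vec ℕ 0) {x : Vec ℕ _} → x ≡ w ++ x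
        empty-++ [] = refl
++ˢ {m = suc m} {G = G} Gᶜ Hᶜ =
  computables-ext ((headᶜ ∘ᶜ Gᶜ) ∷ᶜ ++ˢ {G = λ v → tail (G v)} (tailˢ ∘ˢ Gᶜ) Hᶜ) (λ v → unfold-++ (G v))
  where unfold-++ : ∀ (w : Vec ℕ (suc m)) {x : Vec ℕ _} → head w ∷ (tail w ++ x) ≡ w ++ x
        unfold-++ (_ ∷ _) = refl

-- A step-counting interpreter for μ-recursive codes

-- run e t xs is 0 if e has not halted on xs within budget t, and suc y if it has, with output y.
-- The state of a minimisation search is 0 while every tested argument gave a positive output,
-- 1 once a test has not halted within the budget, and suc (suc y) once y gave output 0.
searchStep : ℕ → ℕ → ℕ → ℕ
searchStep state test z = ifZero state (ifZero test 1 (ifZero (pred test) (suc (suc z)) 0)) state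

mutual
  run : ∀ {n} → Rec n → ℕ → Vec ℕ n → ℕ
  run zer t xs = 1
  run succ t (x ∷ []) = suc (suc x)
  run (proj i) t xs = suc (lookup xs i)
  run (comp f gs) t xs = allPositive (runs gs t xs) * run f t (map pred (runs gs t xs))
  run (prec g h) t (k ∷ xs) = runPrec g h t k xs
  run (mu f) t xs = pred (search f t xs t)

  runs : ∀ {n m} → Vec (Rec n) m → ℕ → Vec ℕ n → Vec ℕ m
  runs [] t xs = []
  runs (g ∷ gs) t xs = run g t xs ∷ runs gs t xs

  runPrec : ∀ {n} → Rec n → Rec (suc (suc n)) → ℕ → ℕ → Vec ℕ n → ℕ
  runPrec g h t zero xs = run g t xs
  runPrec g h t (suc k) xs = sgn (runPrec g h t k xs) * run h t (k ∷ pred (runPrec g h t k xs) ∷ xs)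

  search : ∀ {n} → Rec (suc n) → ℕ → Vec ℕ n → ℕ → ℕ
  search f t xs zero = 0
  search f t xs (suc z) = searchStep (search f t xs z) (run f t (z ∷ xs)) z

mutual
  runᶜ : ∀ {n} (f : Rec n) → Computable {suc n} (λ v → run f (head v) (tail v))
  runᶜ zer = computable-ext (constᶜ 1) (λ { (_ ∷ _) → refl })
  runᶜ succ = computable-ext (sucᶜ ∘ᶜ (sucᶜ ∘ᶜ secondᶜ ∷ᶜ []ᶜ) ∷ᶜ []ᶜ) (λ { (_ ∷ _ ∷ []) → refl })
  runᶜ (proj i) = computable-ext (sucᶜ ∘ᶜ projᶜ (suc i) ∷ᶜ []ᶜ) (λ { (_ ∷ _) → refl })
  runᶜ (comp f gs) =
    *ᶜ ∘ᶜ (allPositiveᶜ ∘ᶜ runsᶜ gs) ∷ᶜ (runᶜ f ∘ᶜ headᶜ ∷ᶜ (map-predˢ ∘ˢ runsᶜ gs)) ∷ᶜ []ᶜ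
  runᶜ (prec g h) = computable-ext (byCounter ∘ᶜ secondᶜ ∷ᶜ headᶜ ∷ᶜ (tailˢ ∘ˢ tailˢ))
                                   (λ { (_ ∷ _ ∷ _) → refl })
    where
      byCounter : Computable (λ v → runPrec g h (head (tail v)) (head v) (tail (tail v)))
      byCounter = recursionᶜ _ (runᶜ g)
        (*ᶜ ∘ᶜ (sgnᶜ ∘ᶜ secondᶜ ∷ᶜ []ᶜ)
            ∷ᶜ (runᶜ h ∘ᶜ thirdᶜ ∷ᶜ headᶜ ∷ᶜ (predᶜ ∘ᶜ secondᶜ ∷ᶜ []ᶜ) ∷ᶜ (tailˢ ∘ˢ tailˢ ∘ˢ tailˢ))
            ∷ᶜ []ᶜ)
        (λ { (_ ∷ _) → refl }) (λ { _ (_ ∷ _) → refl })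
  runᶜ (mu f) = predᶜ ∘ᶜ (byLength ∘ᶜ headᶜ ∷ᶜ idˢ) ∷ᶜ []ᶜ
    where
      test : Computable (λ v → run f (head (tail (tail v))) (head v ∷ tail (tail (tail v))))
      test = runᶜ f ∘ᶜ thirdᶜ ∷ᶜ headᶜ ∷ᶜ (tailˢ ∘ˢ tailˢ ∘ˢ tailˢ)
      byLength : Computable (λ v → search f (head (tail v)) (tail (tail v)) (head v))
      byLength = recursionᶜ _ zeroᶜ
        (ifZeroᶜ ∘ᶜ secondᶜ
                 ∷ᶜ (ifZeroᶜ ∘ᶜ test ∷ᶜ constᶜ 1
                             ∷ᶜ (ifZeroᶜ ∘ᶜ (predᶜ ∘ᶜ test ∷ᶜ []ᶜ) ∷ᶜ (sucᶜ ∘ᶜ (sucᶜ ∘ᶜ headᶜ ∷ᶜ []ᶜ) ∷ᶜ []ᶜ)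
                                         ∷ᶜ constᶜ 0 ∷ᶜ []ᶜ)
                             ∷ᶜ []ᶜ)
                 ∷ᶜ secondᶜ ∷ᶜ []ᶜ)
        (λ { (_ ∷ _) → refl }) (λ { _ (_ ∷ _) → refl })

  runsᶜ : ∀ {n m} (gs : Vec (Rec n) m) → Computables {suc n} (λ v → runs gs (head v) (tail v))
  runsᶜ [] = []ᶜ
  runsᶜ (g ∷ gs) = runᶜ g ∷ᶜ runsᶜ gs

allPositive*≡suc : ∀ {m} (v : Vec ℕ m) w y → allPositive v * w ≡ suc y →
                   v ≡ map suc (map pred v) × w ≡ suc y
allPositive*≡suc [] w y e = refl , trans (sym (+-identityʳ w)) e
allPositive*≡suc (suc x ∷ v) w y e =
  let v≡ , w≡ = allPositive*≡suc v w y (trans (cong (_* w) (sym (+-identityʳ (allPositive v)))) e)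
  in cong (suc x ∷_) v≡ , w≡

allPositive-map-suc : ∀ {m} (zs : Vec ℕ m) → allPositive (map suc zs) ≡ 1
allPositive-map-suc [] = refl
allPositive-map-suc (_ ∷ zs) = trans (+-identityʳ (allPositive (map suc zs))) (allPositive-map-suc zs)

map-pred-map-suc : ∀ {m} (zs : Vec ℕ m) → map pred (map suc zs) ≡ zs
map-pred-map-suc [] = refl
map-pred-map-suc (z ∷ zs) = cong (z ∷_) (map-pred-map-suc zs)

sgn*≡suc : ∀ a w y → sgn a * w ≡ suc y → ∃ λ a' → a ≡ suc a' × w ≡ suc y
sgn*≡suc (suc a) w y e = a , refl , trans (sym (+-identityʳ w)) e

run-comp : ∀ {n m} (f : Rec m) (gs : Vec (Rec n) m) t xs zs y →
           runs gs t xs ≡ map suc zs → run f t zs ≡ suc y → run (comp f gs) t xs ≡ suc y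
run-comp f gs t xs zs y gs↓ f↓ rewrite gs↓ | allPositive-map-suc zs | map-pred-map-suc zs =
  trans (+-identityʳ _) f↓

runPrec-suc : ∀ {n} (g : Rec n) h t k xs z y → runPrec g h t k xs ≡ suc z →
              run h t (k ∷ z ∷ xs) ≡ suc y → runPrec g h t (suc k) xs ≡ suc y
runPrec-suc g h t k xs z y rec↓ h↓ rewrite rec↓ = trans (+-identityʳ _) h↓

RejectsBelow : ∀ {n} → Rec (suc n) → ℕ → Vec ℕ n → ℕ → Set
RejectsBelow f t xs y = ∀ w → w < y → ∃ λ v → run f t (w ∷ xs) ≡ suc (suc v)

search≡0 : ∀ {n} (f : Rec (suc n)) t xs z → search f t xs z ≡ 0 → RejectsBelow f t xs z
search≡0 f t xs (suc z) e w w<z with search f t xs z in e₁ | run f t (z ∷ xs) in e₂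
search≡0 f t xs (suc z) () w w<z | suc _ | _
search≡0 f t xs (suc z) () w w<z | zero | zero
search≡0 f t xs (suc z) () w w<z | zero | suc zero
search≡0 f t xs (suc z) e w w<z | zero | suc (suc v) with m<1+n⇒m<n∨m≡n w<z
... | inj₁ w<z' = search≡0 f t xs z e₁ w w<z'
... | inj₂ refl = v , e₂

search≡found : ∀ {n} (f : Rec (suc n)) t xs z y → search f t xs z ≡ suc (suc y) →
               run f t (y ∷ xs) ≡ 1 × RejectsBelow f t xs y × y < z
search≡found f t xs (suc z) y e with search f t xs z in e₁ | run f t (z ∷ xs) in e₂
search≡found f t xs (suc z) y e | suc _ | _ =
  let y↓ , below , y<z = search≡found f t xs z y (trans e₁ e) in y↓ , below , m<n⇒m<1+n y<z
search≡found f t xs (suc z) y () | zero | zero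
search≡found f t xs (suc z) y refl | zero | suc zero = e₂ , search≡0 f t xs z e₁ , ≤-refl
search≡found f t xs (suc z) y () | zero | suc (suc _)

search-rejecting : ∀ {n} (f : Rec (suc n)) t xs y → RejectsBelow f t xs y →
                   ∀ z → z ≤ y → search f t xs z ≡ 0
search-rejecting f t xs y below zero _ = refl
search-rejecting f t xs y below (suc z) z<y
  rewrite search-rejecting f t xs y below z (<⇒≤ z<y) | proj₂ (below z z<y) = refl

search-finds : ∀ {n} (f : Rec (suc n)) t xs y → run f t (y ∷ xs) ≡ 1 → RejectsBelow f t xs y →
               ∀ z → y < z → search f t xs z ≡ suc (suc y)
search-finds f t xs y y↓ below (suc z) y<1+z with m<1+n⇒m<n∨m≡n y<1+z
... | inj₁ y<z rewrite search-finds f t xs y y↓ below z y<z = refl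
... | inj₂ refl rewrite search-rejecting f t xs y below y ≤-refl | y↓ = refl

pred≡suc : ∀ a y → pred a ≡ suc y → a ≡ suc (suc y)
pred≡suc (suc a) y e = cong suc e

mutual
  run-mono : ∀ {n} (f : Rec n) {t t'} xs y → t ≤ t' → run f t xs ≡ suc y → run f t' xs ≡ suc y
  run-mono zer xs y _ e = e
  run-mono succ (_ ∷ []) y _ e = e
  run-mono (proj i) xs y _ e = e
  run-mono (comp f gs) {t} xs y t≤t' e =
    let gs↓ , f↓ = allPositive*≡suc (runs gs t xs) _ y e
    in run-comp f gs _ xs _ y (runs-mono gs xs _ t≤t' gs↓) (run-mono f _ y t≤t' f↓)
  run-mono (prec g h) (k ∷ xs) y t≤t' e = runPrec-mono g h k xs y t≤t' e
  run-mono (mu f) {t} {t'} xs y t≤t' e =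
    let y↓ , below , y<t = search≡found f t xs t y (pred≡suc _ y e)
    in cong pred (search-finds f t' xs y (run-mono f (y ∷ xs) 0 t≤t' y↓)
                   (λ w w<y → let v , w↓ = below w w<y in v , run-mono f (w ∷ xs) (suc v) t≤t' w↓)
                   t' (<-≤-trans y<t t≤t'))

  runs-mono : ∀ {n m} (gs : Vec (Rec n) m) {t t'} xs zs → t ≤ t' →
              runs gs t xs ≡ map suc zs → runs gs t' xs ≡ map suc zs
  runs-mono [] xs [] _ _ = refl
  runs-mono (g ∷ gs) xs (z ∷ zs) t≤t' e =
    cong₂ _∷_ (run-mono g xs z t≤t' (∷-injectiveˡ e)) (runs-mono gs xs zs t≤t' (∷-injectiveʳ e))

  runPrec-mono : ∀ {n} (g : Rec n) h {t t'} k xs y → t ≤ t' →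
                 runPrec g h t k xs ≡ suc y → runPrec g h t' k xs ≡ suc y
  runPrec-mono g h zero xs y t≤t' e = run-mono g xs y t≤t' e
  runPrec-mono g h {t} (suc k) xs y t≤t' e =
    let z , rec↓ , h↓ = sgn*≡suc (runPrec g h t k xs) _ y e
    in runPrec-suc g h _ k xs z y (runPrec-mono g h k xs z t≤t' rec↓)
         (run-mono h _ y t≤t' (subst (λ r → run h t (k ∷ pred r ∷ xs) ≡ suc y) rec↓ h↓))

mutual
  run-sound : ∀ {n} (f : Rec n) t xs y → run f t xs ≡ suc y → Eval f xs y
  run-sound zer t xs .0 refl = ev-zer
  run-sound succ t (x ∷ []) .(suc x) refl = ev-succ
  run-sound (proj i) t xs .(lookup xs i) refl = ev-proj
  run-sound (comp f gs) t xs y e =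
    let gs↓ , f↓ = allPositive*≡suc (runs gs t xs) _ y e
    in ev-comp (runs-sound gs t xs _ gs↓) (run-sound f t _ y f↓)
  run-sound (prec g h) t (k ∷ xs) y e = runPrec-sound g h t k xs y e
  run-sound (mu f) t xs y e =
    let y↓ , below , _ = search≡found f t xs t y (pred≡suc _ y e)
    in ev-mu (run-sound f t (y ∷ xs) 0 y↓)
             (λ w w<y → let v , w↓ = below w w<y in v , run-sound f t (w ∷ xs) (suc v) w↓)

  runs-sound : ∀ {n m} (gs : Vec (Rec n) m) t xs zs → runs gs t xs ≡ map suc zs → EvalVec gs xs zs
  runs-sound [] t xs [] e = []
  runs-sound (g ∷ gs) t xs (z ∷ zs) e =
    run-sound g t xs z (∷-injectiveˡ e) ∷ runs-sound gs t xs zs (∷-injectiveʳ e)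

  runPrec-sound : ∀ {n} (g : Rec n) h t k xs y → runPrec g h t k xs ≡ suc y → Eval (prec g h) (k ∷ xs) y
  runPrec-sound g h t zero xs y e = ev-prec0 (run-sound g t xs y e)
  runPrec-sound g h t (suc k) xs y e =
    let z , rec↓ , h↓ = sgn*≡suc (runPrec g h t k xs) _ y e
    in ev-precS (runPrec-sound g h t k xs z rec↓)
                (run-sound h t _ y (subst (λ r → run h t (k ∷ pred r ∷ xs) ≡ suc y) rec↓ h↓))

common-stage : ∀ y (P : ℕ → ℕ → Set) → (∀ w {t t'} → t ≤ t' → P w t → P w t') →
               (∀ w → w < y → ∃ (P w)) → ∃ λ t → ∀ w → w < y → P w t
common-stage zero P mono each = 0 , λ _ ()
common-stage (suc y) P mono each
  with common-stage y P mono (λ w w<y → each w (m<n⇒m<1+n w<y)) | each y ≤-refl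
... | t₁ , below | t₂ , at = t₁ ⊔ t₂ , λ w w<1+y → by-cases w (m<1+n⇒m<n∨m≡n w<1+y)
  where by-cases : ∀ w → w < y ⊎ w ≡ y → P w (t₁ ⊔ t₂)
        by-cases w (inj₁ w<y) = mono w (m≤m⊔n t₁ t₂) (below w w<y)
        by-cases w (inj₂ refl) = mono w (m≤n⊔m t₁ t₂) at

mutual
  run-complete : ∀ {n} {f : Rec n} {xs y} → Eval f xs y → ∃ λ t → run f t xs ≡ suc y
  run-complete ev-zer = 0 , refl
  run-complete ev-succ = 0 , refl
  run-complete ev-proj = 0 , refl
  run-complete {f = comp f gs} {xs} {y} (ev-comp {zs = zs} gs↓ f↓)
    with runs-complete gs↓ | run-complete f↓
  ... | t₁ , e₁ | t₂ , e₂ =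
    t₁ ⊔ t₂ , run-comp f gs _ xs zs y (runs-mono gs xs zs (m≤m⊔n t₁ t₂) e₁)
                                      (run-mono f zs y (m≤n⊔m t₁ t₂) e₂)
  run-complete (ev-prec0 g↓) = run-complete g↓
  run-complete {f = prec g h} {suc k ∷ xs} {y} (ev-precS {z = z} rec↓ h↓)
    with run-complete rec↓ | run-complete h↓
  ... | t₁ , e₁ | t₂ , e₂ =
    t₁ ⊔ t₂ , runPrec-suc g h _ k xs z y (runPrec-mono g h k xs z (m≤m⊔n t₁ t₂) e₁)
                                         (run-mono h _ y (m≤n⊔m t₁ t₂) e₂)
  run-complete {f = mu f} {xs} {y} (ev-mu y↓ below↓)
    with run-complete y↓
       | common-stage y (λ w t → ∃ λ v → run f t (w ∷ xs) ≡ suc (suc v))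
                      (λ w t≤t' (v , e) → v , run-mono f (w ∷ xs) (suc v) t≤t' e) (rejections-complete below↓)
  ... | t₀ , e₀ | t₁ , below =
    t , cong pred (search-finds f t xs y (run-mono f (y ∷ xs) 0 t₀≤t e₀)
                    (λ w w<y → let v , e = below w w<y in v , run-mono f (w ∷ xs) (suc v) t₁≤t e) t y<t)
    where t = (t₀ ⊔ t₁) ⊔ suc y
          t₀≤t : t₀ ≤ t
          t₀≤t = ≤-trans (m≤m⊔n t₀ t₁) (m≤m⊔n _ _)
          t₁≤t : t₁ ≤ t
          t₁≤t = ≤-trans (m≤n⊔m t₀ t₁) (m≤m⊔n _ _)
          y<t : y < t
          y<t = m≤n⊔m (t₀ ⊔ t₁) (suc y)

  rejections-complete : ∀ {n} {f : Rec (suc n)} {xs y} → (∀ z → z < y → ∃ λ v → Eval f (z ∷ xs) (suc v)) →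
                        ∀ w → w < y → ∃ λ t → ∃ λ v → run f t (w ∷ xs) ≡ suc (suc v)
  rejections-complete below↓ w w<y =
    let v , w↓ = below↓ w w<y ; t , e = run-complete w↓ in t , v , e

  runs-complete : ∀ {n m} {gs : Vec (Rec n) m} {xs zs} → EvalVec gs xs zs → ∃ λ t → runs gs t xs ≡ map suc zs
  runs-complete [] = 0 , refl
  runs-complete {gs = g ∷ gs} {xs} {z ∷ zs} (g↓ ∷ gs↓) with run-complete g↓ | runs-complete gs↓
  ... | t₁ , e₁ | t₂ , e₂ =
    t₁ ⊔ t₂ , cong₂ _∷_ (run-mono g xs z (m≤m⊔n t₁ t₂) e₁) (runs-mono gs xs zs (m≤n⊔m t₁ t₂) e₂)

-- Semidecision procedures

*-pos : ∀ {a b} → 0 < a → 0 < b → 0 < a * b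
*-pos {suc a} {suc b} _ _ = s≤s z≤n

*-posˡ⁻ : ∀ a b → 0 < a * b → 0 < a
*-posˡ⁻ (suc a) b _ = s≤s z≤n

*-posʳ⁻ : ∀ a b → 0 < a * b → 0 < b
*-posʳ⁻ a (suc b) _ = s≤s z≤n
*-posʳ⁻ a zero p rewrite *-zeroʳ a = p

+-pos⁻ : ∀ a b → 0 < a + b → 0 < a ⊎ 0 < b
+-pos⁻ (suc a) b _ = inj₁ (s≤s z≤n)
+-pos⁻ zero b p = inj₂ p

+-posˡ : ∀ a b → 0 < a → 0 < a + b
+-posˡ a b p = ≤-trans p (m≤m+n a b)

+-posʳ : ∀ a b → 0 < b → 0 < a + b
+-posʳ a b p = ≤-trans p (m≤n+m b a)

sumBelow : (ℕ → ℕ) → ℕ → ℕ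
sumBelow f zero = 0
sumBelow f (suc n) = sumBelow f n + f n

sumBelowᶜ : ∀ {m} {F : Fun (suc m)} → Computable F →
            Computable {suc m} (λ v → sumBelow (λ x → F (x ∷ tail v)) (head v))
sumBelowᶜ Fᶜ = recursionᶜ _ zeroᶜ (+ᶜ ∘ᶜ secondᶜ ∷ᶜ (Fᶜ ∘ᶜ headᶜ ∷ᶜ (tailˢ ∘ˢ tailˢ)) ∷ᶜ []ᶜ)
                 (λ _ → refl) (λ _ _ → refl)

sumBelow-cong : ∀ {f g : ℕ → ℕ} → (∀ x → f x ≡ g x) → ∀ n → sumBelow f n ≡ sumBelow g n
sumBelow-cong f≗g zero = refl
sumBelow-cong f≗g (suc n) = cong₂ _+_ (sumBelow-cong f≗g n) (f≗g n)

sumBelow-pos⁻ : ∀ f n → 0 < sumBelow f n → ∃ λ x → x < n × 0 < f x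
sumBelow-pos⁻ f (suc n) p with +-pos⁻ (sumBelow f n) (f n) p
... | inj₁ q = let x , x<n , fx = sumBelow-pos⁻ f n q in x , m<n⇒m<1+n x<n , fx
... | inj₂ q = n , ≤-refl , q

sumBelow-pos : ∀ f {n} x → x < n → 0 < f x → 0 < sumBelow f n
sumBelow-pos f {suc n} x x<1+n p with m<1+n⇒m<n∨m≡n x<1+n
... | inj₁ x<n = +-posˡ _ _ (sumBelow-pos f x x<n p)
... | inj₂ refl = +-posʳ _ _ p

record Semidecision {n} (A : Vec ℕ n → Set) : Set where
  field
    stage      : Fun (suc n)
    stageᶜ     : Computable stage
    stage-mono : ∀ {t t'} xs → t ≤ t' → 0 < stage (t ∷ xs) → 0 < stage (t' ∷ xs)
    sound      : ∀ t xs → 0 < stage (t ∷ xs) → A xs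
    complete   : ∀ xs → A xs → ∃ λ t → 0 < stage (t ∷ xs)

open Semidecision

listable⇒semidecision : ∀ {n} {A : Vec ℕ n → Set} → Listable A → Semidecision A
listable⇒semidecision (f , A⇔halts) = record
  { stage      = λ v → run f (head v) (tail v)
  ; stageᶜ     = runᶜ f
  ; stage-mono = λ xs t≤t' p → let y , e = positive p in suc-pos (run-mono f xs y t≤t' e)
  ; sound      = λ t xs p → let y , e = positive p in Equivalence.from (A⇔halts xs) (y , run-sound f t xs y e)
  ; complete   = λ xs a → let y , ev = Equivalence.to (A⇔halts xs) a ; t , e = run-complete ev in t , suc-pos e
  }
  where
    positive : ∀ {a} → 0 < a → ∃ λ y → a ≡ suc y
    positive {suc a} _ = a , refl
    suc-pos : ∀ {a y} → a ≡ suc y → 0 < a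
    suc-pos refl = s≤s z≤n

sd-⇔ : ∀ {n} {A B : Vec ℕ n → Set} → Semidecision A → (∀ xs → A xs → B xs) → (∀ xs → B xs → A xs) →
       Semidecision B
sd-⇔ S A⇒B B⇒A = record
  { stage = stage S ; stageᶜ = stageᶜ S ; stage-mono = stage-mono S
  ; sound = λ t xs p → A⇒B xs (sound S t xs p)
  ; complete = λ xs b → complete S xs (B⇒A xs b) }

sd-all : ∀ {n} {A : Vec ℕ n → Set} → (∀ xs → A xs) → Semidecision A
sd-all a = record
  { stage = λ _ → 1 ; stageᶜ = constᶜ 1 ; stage-mono = λ _ _ p → p
  ; sound = λ _ xs _ → a xs ; complete = λ _ _ → 0 , s≤s z≤n }

sd-∘ : ∀ {p n} {A : Vec ℕ n → Set} (σ : Vec ℕ p → Vec ℕ n) → Computables σ → Semidecision A →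
       Semidecision (λ xs → A (σ xs))
sd-∘ σ σᶜ S = record
  { stage = λ v → stage S (head v ∷ σ (tail v))
  ; stageᶜ = stageᶜ S ∘ᶜ headᶜ ∷ᶜ (σᶜ ∘ˢ tailˢ)
  ; stage-mono = λ xs → stage-mono S (σ xs)
  ; sound = λ t xs → sound S t (σ xs)
  ; complete = λ xs → complete S (σ xs) }

sd-∧ : ∀ {n} {A B : Vec ℕ n → Set} → Semidecision A → Semidecision B → Semidecision (λ xs → A xs × B xs)
sd-∧ SA SB = record
  { stage = λ v → stage SA v * stage SB v
  ; stageᶜ = *ᶜ ∘ᶜ stageᶜ SA ∷ᶜ stageᶜ SB ∷ᶜ []ᶜ
  ; stage-mono = λ {t} xs t≤t' p →
      *-pos (stage-mono SA xs t≤t' (*-posˡ⁻ (stage SA (t ∷ xs)) _ p))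
            (stage-mono SB xs t≤t' (*-posʳ⁻ (stage SA (t ∷ xs)) _ p))
  ; sound = λ t xs p → sound SA t xs (*-posˡ⁻ (stage SA (t ∷ xs)) _ p)
                     , sound SB t xs (*-posʳ⁻ (stage SA (t ∷ xs)) _ p)
  ; complete = λ xs (a , b) → let t₁ , p₁ = complete SA xs a ; t₂ , p₂ = complete SB xs b in
      t₁ ⊔ t₂ , *-pos (stage-mono SA xs (m≤m⊔n t₁ t₂) p₁) (stage-mono SB xs (m≤n⊔m t₁ t₂) p₂) }

sd-∨ : ∀ {n} {A B : Vec ℕ n → Set} → Semidecision A → Semidecision B → Semidecision (λ xs → A xs ⊎ B xs)
sd-∨ {A = A} {B} SA SB = record
  { stage = λ v → stage SA v + stage SB v
  ; stageᶜ = +ᶜ ∘ᶜ stageᶜ SA ∷ᶜ stageᶜ SB ∷ᶜ []ᶜ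
  ; stage-mono = λ xs t≤t' p → either-mono xs t≤t' (+-pos⁻ _ _ p)
  ; sound = λ t xs p → either-sound t xs (+-pos⁻ _ _ p)
  ; complete = either-complete }
  where
    either-mono : ∀ {t t'} xs → t ≤ t' → 0 < stage SA (t ∷ xs) ⊎ 0 < stage SB (t ∷ xs) →
           0 < stage SA (t' ∷ xs) + stage SB (t' ∷ xs)
    either-mono xs t≤t' (inj₁ p) = +-posˡ _ _ (stage-mono SA xs t≤t' p)
    either-mono xs t≤t' (inj₂ p) = +-posʳ _ _ (stage-mono SB xs t≤t' p)
    either-sound : ∀ t xs → 0 < stage SA (t ∷ xs) ⊎ 0 < stage SB (t ∷ xs) → A xs ⊎ B xs
    either-sound t xs (inj₁ p) = inj₁ (sound SA t xs p)
    either-sound t xs (inj₂ p) = inj₂ (sound SB t xs p)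
    either-complete : ∀ xs → A xs ⊎ B xs → ∃ λ t → 0 < stage SA (t ∷ xs) + stage SB (t ∷ xs)
    either-complete xs (inj₁ a) = let t , p = complete SA xs a in t , +-posˡ _ _ p
    either-complete xs (inj₂ b) = let t , p = complete SB xs b in t , +-posʳ _ _ p

-- At stage t the witness is searched below t + 1, so witnesses and stages grow together.
sd-∃ : ∀ {n} {A : Vec ℕ (suc n) → Set} → Semidecision A → Semidecision (λ xs → ∃ λ x → A (x ∷ xs))
sd-∃ {n} S = record
  { stage = stage∃
  ; stageᶜ = sumBelowᶜ (stageᶜ S ∘ᶜ secondᶜ ∷ᶜ headᶜ ∷ᶜ (tailˢ ∘ˢ tailˢ)) ∘ᶜ (sucᶜ ∘ᶜ headᶜ ∷ᶜ []ᶜ) ∷ᶜ idˢ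
  ; stage-mono = λ {t} {t'} xs t≤t' p →
      let x , x≤t , q = sumBelow-pos⁻ (λ x → stage S (t ∷ x ∷ xs)) (suc t) p
      in sumBelow-pos (λ x → stage S (t' ∷ x ∷ xs)) x (≤-trans x≤t (s≤s t≤t')) (stage-mono S (x ∷ xs) t≤t' q)
  ; sound = λ t xs p →
      let x , _ , q = sumBelow-pos⁻ (λ x → stage S (t ∷ x ∷ xs)) (suc t) p in x , sound S t (x ∷ xs) q
  ; complete = λ xs (x , a) → let t , q = complete S (x ∷ xs) a in
      t ⊔ x , sumBelow-pos _ x (s≤s (m≤n⊔m t x)) (stage-mono S (x ∷ xs) (m≤m⊔n t x) q) }
  where stage∃ : Fun (suc n)
        stage∃ v = sumBelow (λ x → stage S (head v ∷ x ∷ tail v)) (suc (head v))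

sd-∃ⁿ : ∀ m {n} {B : Vec ℕ (m + n) → Set} → Semidecision B →
        Semidecision (λ xs → ∃ λ (ys : Vec ℕ m) → B (ys ++ xs))
sd-∃ⁿ zero S = sd-⇔ S (λ _ b → [] , b) (λ { _ ([] , b) → b })
sd-∃ⁿ (suc m) {n} {B} S =
  sd-⇔ (sd-∃ⁿ m {n} {λ v → ∃ λ y → B (y ∷ v)} (sd-∃ S))
       (λ { _ (ys , y , b) → (y ∷ ys) , b }) (λ { _ ((y ∷ ys) , b) → ys , y , b })

take-++ : ∀ {a n} (ys : Vec ℕ a) (xs : Vec ℕ n) → take a (ys ++ xs) ≡ ys
take-++ [] xs = refl
take-++ (y ∷ ys) xs = cong (y ∷_) (take-++ ys xs)

drop-++ : ∀ {a n} (ys : Vec ℕ a) (xs : Vec ℕ n) → drop a (ys ++ xs) ≡ xs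
drop-++ [] xs = refl
drop-++ (y ∷ ys) xs = drop-++ ys xs

sd-∃-split : ∀ a {n} {B : Vec ℕ a → Vec ℕ n → Set} → Semidecision (λ v → B (take a v) (drop a v)) →
             Semidecision (λ xs → ∃ λ ys → B ys xs)
sd-∃-split a {B = B} S =
  sd-⇔ (sd-∃ⁿ a S)
       (λ xs (ys , b) → ys , subst₂ B (take-++ ys xs) (drop-++ ys xs) b)
       (λ xs (ys , b) → ys , subst₂ B (sym (take-++ ys xs)) (sym (drop-++ ys xs)) b)

-- leastUpTo f w is the least z ≤ w with f z positive, or w if there is none.
leastUpTo : (ℕ → ℕ) → ℕ → ℕ
leastUpTo f zero = 0
leastUpTo f (suc w) = ifZero (f (leastUpTo f w)) (suc w) (leastUpTo f w)

leastUpTo-none : ∀ (f : ℕ → ℕ) w → f (leastUpTo f w) ≡ 0 → leastUpTo f w ≡ w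
leastUpTo-none f zero _ = refl
leastUpTo-none f (suc w) e with f (leastUpTo f w) in fw
... | zero = refl
... | suc _ with trans (sym fw) e
... | ()

leastUpTo-least : ∀ (f : ℕ → ℕ) w z → z < leastUpTo f w → f z ≡ 0
leastUpTo-least f (suc w) z z< with f (leastUpTo f w) in fw
... | suc _ = leastUpTo-least f w z z<
... | zero with m<1+n⇒m<n∨m≡n z<
...   | inj₁ z<w = leastUpTo-least f w z (subst (z <_) (sym (leastUpTo-none f w fw)) z<w)
...   | inj₂ refl = subst (λ y → f y ≡ 0) (leastUpTo-none f w fw) fw

leastUpTo-pos : ∀ (f : ℕ → ℕ) w z → z ≤ w → 0 < f z → 0 < f (leastUpTo f w)
leastUpTo-pos f zero .zero z≤n p = p
leastUpTo-pos f (suc w) z z≤1+w p with f (leastUpTo f w) in fw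
... | suc _ = subst (0 <_) (sym fw) (s≤s z≤n)
... | zero with m≤n⇒m<n∨m≡n z≤1+w
...   | inj₂ refl = p
...   | inj₁ z<1+w with subst (0 <_) fw (leastUpTo-pos f w z (≤-pred z<1+w) p)
...     | ()

μᶜ : ∀ {n} {F : Fun (suc n)} → Computable F → (∀ xs → ∃ λ z → 0 < F (z ∷ xs)) →
     Σ (Fun n) λ m → Computable m × ∀ xs → 0 < F (m xs ∷ xs)
μᶜ {n} {F} Fᶜ exists = least , (mu (proj₁ isZeroᶜ) , evaluates) , least-pos
  where
    isZeroᶜ : Computable (λ v → ifZero (F v) 1 0)
    isZeroᶜ = ifZeroᶜ ∘ᶜ Fᶜ ∷ᶜ constᶜ 1 ∷ᶜ constᶜ 0 ∷ᶜ []ᶜ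
    least : Fun n
    least xs = leastUpTo (λ z → F (z ∷ xs)) (proj₁ (exists xs))
    least-pos : ∀ xs → 0 < F (least xs ∷ xs)
    least-pos xs = leastUpTo-pos (λ z → F (z ∷ xs)) _ _ ≤-refl (proj₂ (exists xs))
    positive-test : ∀ {a} → 0 < a → ifZero a 1 0 ≡ 0
    positive-test {suc a} _ = refl
    evaluates : ∀ xs → Eval (mu (proj₁ isZeroᶜ)) xs (least xs)
    evaluates xs =
      ev-mu (subst (Eval (proj₁ isZeroᶜ) (least xs ∷ xs)) (positive-test (least-pos xs))
                   (proj₂ isZeroᶜ (least xs ∷ xs)))
            (λ z z< → 0 , subst (λ q → Eval (proj₁ isZeroᶜ) (z ∷ xs) (ifZero q 1 0))
                                (leastUpTo-least (λ z → F (z ∷ xs)) (proj₁ (exists xs)) z z<)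
                                (proj₂ isZeroᶜ (z ∷ xs)))

sd-positive : ∀ {n} {F : Fun n} → Computable F → Semidecision (λ xs → 0 < F xs)
sd-positive {F = F} Fᶜ = record
  { stage = λ v → F (tail v) ; stageᶜ = Fᶜ ∘ᶜ tailˢ ; stage-mono = λ _ _ p → p
  ; sound = λ _ _ p → p ; complete = λ _ p → 0 , p }

-- First search for a stage at which some witness is accepted, then for the least such witness.
sd-choice : ∀ {n} {A : Vec ℕ (suc n) → Set} → Semidecision A → (∀ xs → ∃ λ x → A (x ∷ xs)) →
            Σ (Fun n) λ f → Computable f × ∀ xs → A (f xs ∷ xs)
sd-choice {n} {A} S total = choose , chooseᶜ , λ xs → sound S _ _ (choose-accepted xs)
  where
    E : Semidecision (λ xs → ∃ λ x → A (x ∷ xs))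
    E = sd-∃ S
    stageFound : Σ (Fun n) λ m → Computable m × ∀ xs → 0 < stage E (m xs ∷ xs)
    stageFound = μᶜ (stageᶜ E) (λ xs → complete E xs (total xs))
    found : Fun n
    found = proj₁ stageFound
    witnessFound : Σ (Fun n) λ m → Computable m × ∀ xs → 0 < stage S (found xs ∷ m xs ∷ xs)
    witnessFound = μᶜ {F = λ v → stage S (found (tail v) ∷ v)}
                      (stageᶜ S ∘ᶜ (proj₁ (proj₂ stageFound) ∘ᶜ tailˢ) ∷ᶜ idˢ)
                      (λ xs → let x , _ , q = sumBelow-pos⁻ (λ x → stage S (found xs ∷ x ∷ xs)) (suc (found xs))
                                                      (proj₂ (proj₂ stageFound) xs)
                              in x , q)
    choose : Fun n
    choose = proj₁ witnessFound
    chooseᶜ : Computable choose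
    chooseᶜ = proj₁ (proj₂ witnessFound)
    choose-accepted : ∀ xs → 0 < stage S (found xs ∷ choose xs ∷ xs)
    choose-accepted = proj₂ (proj₂ witnessFound)

-- P.e. definable sets under a listable presentation

GraphOf⇒≡ : ∀ {A : Set} {r} (F : Vec A r → A) (xs : Vec A r) y → GraphOf F (xs ∷ʳ y) → F xs ≡ y
GraphOf⇒≡ F [] y gr = gr
GraphOf⇒≡ F (x ∷ xs) y gr = GraphOf⇒≡ (λ zs → F (x ∷ zs)) xs y gr

≡⇒GraphOf : ∀ {A : Set} {r} (F : Vec A r → A) (xs : Vec A r) y → F xs ≡ y → GraphOf F (xs ∷ʳ y)
≡⇒GraphOf F [] y e = e
≡⇒GraphOf F (x ∷ xs) y e = ≡⇒GraphOf (λ zs → F (x ∷ zs)) xs y e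

GraphOf-map⁻ : ∀ {A : Set} {r} (F : Vec A r → A) (σ : ℕ → A) (ns : Vec ℕ r) n →
               GraphOf F (map σ (ns ∷ʳ n)) → F (map σ ns) ≡ σ n
GraphOf-map⁻ F σ ns n gr = GraphOf⇒≡ F (map σ ns) (σ n) (subst (GraphOf F) (map-∷ʳ σ n ns) gr)

GraphOf-map : ∀ {A : Set} {r} (F : Vec A r → A) (σ : ℕ → A) (ns : Vec ℕ r) n →
              F (map σ ns) ≡ σ n → GraphOf F (map σ (ns ∷ʳ n))
GraphOf-map F σ ns n e = subst (GraphOf F) (sym (map-∷ʳ σ n ns)) (≡⇒GraphOf F (map σ ns) (σ n) e)

map-head∷tail : ∀ {A : Set} {a} (f : ℕ → A) (w : Vec ℕ (suc a)) → map f w ≡ f (head w) ∷ map f (tail w)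
map-head∷tail f (_ ∷ _) = refl

module Presentation {L : Language} (𝔐 : Structure L) {ρ : ℕ → Structure.Carrier 𝔐}
                    (P : IsListablePresentation 𝔐 ρ) where
  open Language L
  open Structure 𝔐
  open IsListablePresentation P

  indices : ∀ {a} (w : Vec Carrier a) → ∃ λ (ms : Vec ℕ a) → map ρ ms ≡ w
  indices [] = [] , refl
  indices (x ∷ w) = let m , e = surjective x ; ms , es = indices w in (m ∷ ms) , cong₂ _∷_ e es

  ≡-sd : Semidecision {2} (λ v → ρ (head v) ≡ ρ (head (tail v)))
  ≡-sd = sd-⇔ (listable⇒semidecision eqListable) (λ { (_ ∷ _ ∷ []) e → e }) (λ { (_ ∷ _ ∷ []) e → e })

  rel-sd : ∀ R → Semidecision (λ ns → relI R (map ρ ns))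
  rel-sd R = listable⇒semidecision (relListable R)

  graph-sd : ∀ f → Semidecision (λ ns → funGraph 𝔐 f (map ρ ns))
  graph-sd f = listable⇒semidecision (funListable f)

  mutual
    term-sd : ∀ {n} (t : Term 𝔐 n) → Semidecision (λ v → evalT 𝔐 (map ρ (tail v)) t ≡ ρ (head v))
    term-sd (var i) =
      sd-⇔ (sd-∘ (λ v → lookup (tail v) i ∷ head v ∷ []) (lookupᶜ ∷ᶜ headᶜ ∷ᶜ []ᶜ) ≡-sd)
           (λ { (m ∷ ns) e → trans (lookup-map i ρ ns) e })
           (λ { (m ∷ ns) e → trans (sym (lookup-map i ρ ns)) e })
      where lookupᶜ : Computable (λ v → lookup (tail v) i)
            lookupᶜ = computable-ext (projᶜ (suc i)) (λ { (_ ∷ _) → refl })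
    term-sd (app f ts) =
      sd-⇔ (sd-∃-split a {B = B} (sd-∧ (terms-sd ts (takeˢ a) (tailˢ ∘ˢ dropˢ a))
                                (sd-∘ (λ v → take a v ∷ʳ head (drop a v))
                                      (∷ʳˢ (takeˢ a) (headᶜ ∘ᶜ dropˢ a)) (graph-sd f))))
           (λ { (m ∷ ns) (ms , e , gr) →
                  trans (cong (funI f) e) (GraphOf-map⁻ (funI f) ρ ms m gr) })
           (λ { (m ∷ ns) e → let ms , ρms = indices (evalTs 𝔐 (map ρ ns) ts) in
                  ms , sym ρms , GraphOf-map (funI f) ρ ms m (trans (cong (funI f) ρms) e) })
      where
        a : ℕ
        a = funArity f
        B : Vec ℕ a → Vec ℕ (suc _) → Set
        B ms xs = evalTs 𝔐 (map ρ (tail xs)) ts ≡ map ρ ms × funGraph 𝔐 f (map ρ (ms ∷ʳ head xs))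

    terms-sd : ∀ {p n a} {σ₁ : Vec ℕ p → Vec ℕ a} {σ₂ : Vec ℕ p → Vec ℕ n} (ts : Vec (Term 𝔐 n) a) →
               Computables σ₁ → Computables σ₂ →
               Semidecision (λ v → evalTs 𝔐 (map ρ (σ₂ v)) ts ≡ map ρ (σ₁ v))
    terms-sd {σ₁ = σ₁} [] _ _ = sd-all (λ v → empty (σ₁ v))
      where empty : (w : Vec ℕ 0) → [] ≡ map ρ w
            empty [] = refl
    terms-sd {σ₁ = σ₁} {σ₂} (t ∷ ts) σ₁ᶜ σ₂ᶜ =
      sd-⇔ (sd-∧ (sd-∘ (λ v → head (σ₁ v) ∷ σ₂ v) ((headᶜ ∘ᶜ σ₁ᶜ) ∷ᶜ σ₂ᶜ) (term-sd t))
                 (terms-sd ts (tailˢ ∘ˢ σ₁ᶜ) σ₂ᶜ))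
           (λ v (e , es) → trans (cong₂ _∷_ e es) (sym (map-head∷tail ρ (σ₁ v))))
           (λ v e → let e' = trans e (map-head∷tail ρ (σ₁ v)) in ∷-injectiveˡ e' , ∷-injectiveʳ e')

  sat-sd : ∀ {n} (φ : PEFormula 𝔐 n) → Semidecision (λ v → Sat 𝔐 φ (map ρ v))
  sat-sd (s ≐ t) =
    sd-⇔ (sd-∃ (sd-∧ (term-sd s) (term-sd t)))
         (λ { _ (_ , s↦m , t↦m) → trans s↦m (sym t↦m) })
         (λ ns e → let m , ρm = surjective (evalT 𝔐 (map ρ ns) t) in m , trans e (sym ρm) , sym ρm)
  sat-sd (rel R ts) =
    sd-⇔ (sd-∃-split a {B = B} (sd-∧ (terms-sd ts (takeˢ a) (dropˢ a)) (sd-∘ (take a) (takeˢ a) (rel-sd R))))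
         (λ { _ (_ , e , r) → subst (relI R) (sym e) r })
         (λ ns r → let ms , ρms = indices (evalTs 𝔐 (map ρ ns) ts) in
                   ms , sym ρms , subst (relI R) (sym ρms) r)
    where
      a : ℕ
      a = relArity R
      B : Vec ℕ a → Vec ℕ _ → Set
      B ms ns = evalTs 𝔐 (map ρ ns) ts ≡ map ρ ms × relI R (map ρ ms)
  sat-sd (φ ∧' ψ) = sd-∧ (sat-sd φ) (sat-sd ψ)
  sat-sd (φ ∨' ψ) = sd-∨ (sat-sd φ) (sat-sd ψ)
  sat-sd (∃' φ) =
    sd-⇔ (sd-∃ (sat-sd φ))
         (λ { _ (m , s) → ρ m , s })
         (λ { ns (x , s) → let m , ρm = surjective x in m , subst (λ y → Sat 𝔐 φ (y ∷ map ρ ns)) (sym ρm) s })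

  pe-definable-sd : ∀ {n} {A : Vec Carrier n → Set} → PEDefinableSet 𝔐 A → Semidecision (λ v → A (map ρ v))
  pe-definable-sd (φ , φ⇔A) =
    sd-⇔ (sat-sd φ) (λ v → Equivalence.to (φ⇔A (map ρ v))) (λ v → Equivalence.from (φ⇔A (map ρ v)))

-- Binary digits and pairing

parity : ℕ → ℕ
parity zero = 0
parity (suc n) = ifZero (parity n) 1 0

half : ℕ → ℕ
half zero = 0
half (suc n) = half n + parity n

halveTimes : ℕ → ℕ → ℕ
halveTimes x zero = x
halveTimes x (suc i) = half (halveTimes x i)

bit : ℕ → ℕ → ℕ
bit x i = parity (halveTimes x i)

encode : (ℕ → ℕ) → ℕ → ℕ
encode f N = sumBelow (λ j → f j * 2 ^ j) N

parityᶜ : Computable {1} (λ v → parity (head v))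
parityᶜ = recursionᶜ _ zeroᶜ (ifZeroᶜ ∘ᶜ projᶜ (suc zero) ∷ᶜ constᶜ 1 ∷ᶜ constᶜ 0 ∷ᶜ []ᶜ)
            (λ { [] → refl }) (λ { _ [] → refl })

halfᶜ : Computable {1} (λ v → half (head v))
halfᶜ = recursionᶜ _ zeroᶜ (+ᶜ ∘ᶜ projᶜ (suc zero) ∷ᶜ (parityᶜ ∘ᶜ projᶜ zero ∷ᶜ []ᶜ) ∷ᶜ []ᶜ)
          (λ { [] → refl }) (λ { _ [] → refl })

bitᶜ : Computable {2} (λ v → bit (head (tail v)) (head v))
bitᶜ = parityᶜ ∘ᶜ halveTimesᶜ ∷ᶜ []ᶜ
  where halveTimesᶜ : Computable {2} (λ v → halveTimes (head (tail v)) (head v))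
        halveTimesᶜ = recursionᶜ _ (projᶜ zero) (halfᶜ ∘ᶜ projᶜ (suc zero) ∷ᶜ []ᶜ)
                        (λ { (_ ∷ []) → refl }) (λ { _ (_ ∷ []) → refl })

2^ᶜ : Computable {1} (λ v → 2 ^ head v)
2^ᶜ = recursionᶜ _ (constᶜ 1) (*ᶜ ∘ᶜ constᶜ 2 ∷ᶜ projᶜ (suc zero) ∷ᶜ []ᶜ) (λ { [] → refl }) (λ { _ [] → refl })

parity-double : ∀ y → parity (y + y) ≡ 0
parity-double zero = refl
parity-double (suc y) rewrite +-suc y y | parity-double y = refl

half-double : ∀ y → half (y + y) ≡ y
half-double zero = refl
half-double (suc y) rewrite +-suc y y | half-double y | parity-double y | +-identityʳ y = +-comm y 1

parity-digit : ∀ u y → u ≤ 1 → parity (u + (y + y)) ≡ u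
parity-digit zero y _ = parity-double y
parity-digit (suc zero) y _ rewrite parity-double y = refl
parity-digit (suc (suc _)) y (s≤s ())

half-digit : ∀ u y → u ≤ 1 → half (u + (y + y)) ≡ y
half-digit zero y _ = half-double y
half-digit (suc zero) y _ rewrite half-double y | parity-double y = +-identityʳ y
half-digit (suc (suc _)) y (s≤s ())

halveTimes-suc : ∀ x i → halveTimes x (suc i) ≡ halveTimes (half x) i
halveTimes-suc x zero = refl
halveTimes-suc x (suc i) = cong half (halveTimes-suc x i)

bit-zero : ∀ i → bit 0 i ≡ 0
bit-zero i = cong parity (halveTimes-0 i)
  where halveTimes-0 : ∀ i → halveTimes 0 i ≡ 0
        halveTimes-0 zero = refl
        halveTimes-0 (suc i) = cong half (halveTimes-0 i)

encode-suc : ∀ f N → encode f (suc N) ≡ f 0 + (encode (λ j → f (suc j)) N + encode (λ j → f (suc j)) N)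
encode-suc f zero = trans (*-identityʳ (f 0)) (sym (+-identityʳ (f 0)))
encode-suc f (suc N) rewrite encode-suc f N = shift (f 0) (encode (λ j → f (suc j)) N) (f (suc N)) (2 ^ N)
  where shift : ∀ a s c p → (a + (s + s)) + c * (2 * p) ≡ a + ((s + c * p) + (s + c * p))
        shift = solve-∀

bit-encode : ∀ f N i → (∀ j → f j ≤ 1) → i < N → bit (encode f N) i ≡ f i
bit-encode f (suc N) zero digits _ rewrite encode-suc f N =
  parity-digit (f 0) (encode (λ j → f (suc j)) N) (digits 0)
bit-encode f (suc N) (suc i) digits (s≤s i<N)
  rewrite halveTimes-suc (encode f (suc N)) i | encode-suc f N
        | half-digit (f 0) (encode (λ j → f (suc j)) N) (digits 0)
  = bit-encode (λ j → f (suc j)) N i (λ j → digits (suc j)) i<N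

-- modSuc t i and divSuc t i are the remainder and the quotient of i divided by t + 1.
modSuc : ℕ → ℕ → ℕ
modSuc t zero = 0
modSuc t (suc i) = ifZero (t ∸ modSuc t i) 0 (suc (modSuc t i))

divSuc : ℕ → ℕ → ℕ
divSuc t zero = 0
divSuc t (suc i) = divSuc t i + ifZero (t ∸ modSuc t i) 1 0

modSucᶜ : Computable {2} (λ v → modSuc (head (tail v)) (head v))
modSucᶜ = recursionᶜ _ zeroᶜ
  (ifZeroᶜ ∘ᶜ (∸ᶜ ∘ᶜ thirdᶜ ∷ᶜ secondᶜ ∷ᶜ []ᶜ) ∷ᶜ constᶜ 0 ∷ᶜ (sucᶜ ∘ᶜ secondᶜ ∷ᶜ []ᶜ) ∷ᶜ []ᶜ)
  (λ { (_ ∷ []) → refl }) (λ { _ (_ ∷ []) → refl })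

divSucᶜ : Computable {2} (λ v → divSuc (head (tail v)) (head v))
divSucᶜ = recursionᶜ _ zeroᶜ
  (+ᶜ ∘ᶜ secondᶜ
       ∷ᶜ (ifZeroᶜ ∘ᶜ (∸ᶜ ∘ᶜ thirdᶜ ∷ᶜ (modSucᶜ ∘ᶜ headᶜ ∷ᶜ thirdᶜ ∷ᶜ []ᶜ) ∷ᶜ []ᶜ)
                   ∷ᶜ constᶜ 1 ∷ᶜ constᶜ 0 ∷ᶜ []ᶜ)
       ∷ᶜ []ᶜ)
  (λ { (_ ∷ []) → refl }) (λ { _ (_ ∷ []) → refl })

pairIndex : ℕ → ℕ → ℕ → ℕ
pairIndex t a b = a * suc t + b

square : ℕ → ℕ
square t = suc t * suc t

pairIndex-next-column : ∀ t a b → pairIndex t a (suc b) ≡ suc (pairIndex t a b)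
pairIndex-next-column t a b = +-suc (a * suc t) b

pairIndex-next-row : ∀ t a → pairIndex t (suc a) 0 ≡ suc (pairIndex t a t)
pairIndex-next-row t a = cong suc (shift t a)
  where shift : ∀ t a → t + a * suc t + 0 ≡ a * suc t + t
        shift = solve-∀

Decodes : ℕ → ℕ → ℕ → Set
Decodes t a b = modSuc t (pairIndex t a b) ≡ b × divSuc t (pairIndex t a b) ≡ a

decodes-column : ∀ t a → Decodes t a 0 → ∀ b → b ≤ t → Decodes t a b
decodes-column t a row zero _ = row
decodes-column t a row (suc b) b<t with decodes-column t a row b (<⇒≤ b<t)
... | mod≡b , div≡a rewrite pairIndex-next-column t a b | mod≡b | div≡a with t ∸ b in t∸b
... | zero = ⊥-elim (<-irrefl refl (≤-<-trans (m∸n≡0⇒m≤n t∸b) b<t))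
... | suc _ = refl , +-identityʳ a

decodes-row : ∀ t a → Decodes t a 0
decodes-row t zero = refl , refl
decodes-row t (suc a) =
  subst (λ i → modSuc t i ≡ 0 × divSuc t i ≡ suc a) (sym (pairIndex-next-row t a))
        (wrap (decodes-column t a (decodes-row t a) t ≤-refl))
  where wrap : Decodes t a t → modSuc t (suc (pairIndex t a t)) ≡ 0 × divSuc t (suc (pairIndex t a t)) ≡ suc a
        wrap (mod≡t , div≡a) rewrite mod≡t | div≡a | n∸n≡0 t = refl , +-comm a 1

pairIndex-decodes : ∀ t a b → b ≤ t → Decodes t a b
pairIndex-decodes t a b = decodes-column t a (decodes-row t a) b

pairIndex<square : ∀ t a b → a ≤ t → b ≤ t → pairIndex t a b < square t
pairIndex<square t a b a≤t b≤t =
  ≤-trans (s≤s (+-mono-≤ (*-monoˡ-≤ (suc t) a≤t) b≤t)) (≤-reflexive (last-index t))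
  where last-index : ∀ t → suc (t * suc t + t) ≡ suc t * suc t
        last-index = solve-∀

χ≡ : ℕ → ℕ → ℕ
χ≡ a b = ifZero ((a ∸ b) + (b ∸ a)) 1 0

χ≡ᶜ : Computable {2} (λ v → χ≡ (head v) (head (tail v)))
χ≡ᶜ = ifZeroᶜ ∘ᶜ (+ᶜ ∘ᶜ (∸ᶜ ∘ᶜ headᶜ ∷ᶜ secondᶜ ∷ᶜ []ᶜ) ∷ᶜ (∸ᶜ ∘ᶜ secondᶜ ∷ᶜ headᶜ ∷ᶜ []ᶜ) ∷ᶜ []ᶜ)
             ∷ᶜ constᶜ 1 ∷ᶜ constᶜ 0 ∷ᶜ []ᶜ

χ≡-pos⁻ : ∀ a b → 0 < χ≡ a b → a ≡ b
χ≡-pos⁻ a b p with (a ∸ b) + (b ∸ a) in distance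
... | zero = ≤-antisym (m∸n≡0⇒m≤n (m+n≡0⇒m≡0 _ distance)) (m∸n≡0⇒m≤n (m+n≡0⇒n≡0 (a ∸ b) distance))
χ≡-pos⁻ a b () | suc _

χ≡-refl : ∀ a → 0 < χ≡ a a
χ≡-refl a rewrite n∸n≡0 a = s≤s z≤n

χ≤ : ℕ → ℕ → ℕ
χ≤ a b = ifZero (a ∸ b) 1 0

χ≤ᶜ : Computable {2} (λ v → χ≤ (head v) (head (tail v)))
χ≤ᶜ = ifZeroᶜ ∘ᶜ (∸ᶜ ∘ᶜ headᶜ ∷ᶜ secondᶜ ∷ᶜ []ᶜ) ∷ᶜ constᶜ 1 ∷ᶜ constᶜ 0 ∷ᶜ []ᶜ

χ≤-pos⁻ : ∀ a b → 0 < χ≤ a b → a ≤ b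
χ≤-pos⁻ a b p with a ∸ b in a∸b
... | zero = m∸n≡0⇒m≤n a∸b
χ≤-pos⁻ a b () | suc _

χ≤-pos : ∀ {a b} → a ≤ b → 0 < χ≤ a b
χ≤-pos a≤b rewrite m≤n⇒m∸n≡0 a≤b = s≤s z≤n

sumFin : ∀ {k} → (Fin k → ℕ) → ℕ
sumFin {zero} h = 0
sumFin {suc k} h = h zero + sumFin (λ j → h (suc j))

sumFinᶜ : ∀ {k n} {H : Fin k → Fun n} → (∀ j → Computable (H j)) → Computable (λ v → sumFin (λ j → H j v))
sumFinᶜ {zero} _ = constᶜ 0
sumFinᶜ {suc k} Hᶜ = +ᶜ ∘ᶜ Hᶜ zero ∷ᶜ sumFinᶜ (λ j → Hᶜ (suc j)) ∷ᶜ []ᶜ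

sumFin-cong : ∀ {k} {f g : Fin k → ℕ} → (∀ j → f j ≡ g j) → sumFin f ≡ sumFin g
sumFin-cong {zero} _ = refl
sumFin-cong {suc k} f≗g = cong₂ _+_ (f≗g zero) (sumFin-cong (λ j → f≗g (suc j)))

sumFin-pos⁻ : ∀ {k} (h : Fin k → ℕ) → 0 < sumFin h → ∃ λ j → 0 < h j
sumFin-pos⁻ {suc k} h p with +-pos⁻ (h zero) _ p
... | inj₁ q = zero , q
... | inj₂ q = let j , r = sumFin-pos⁻ (λ j → h (suc j)) q in suc j , r

sumFin-pos : ∀ {k} (h : Fin k → ℕ) j → 0 < h j → 0 < sumFin h
sumFin-pos h zero p = +-posˡ _ _ p
sumFin-pos h (suc j) p = +-posʳ (h zero) _ (sumFin-pos (λ j → h (suc j)) j p)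

sumVecs : ∀ r → (Vec ℕ r → ℕ) → ℕ → ℕ
sumVecs zero G N = G []
sumVecs (suc r) G N = sumBelow (λ x → sumVecs r (λ is → G (x ∷ is)) N) N

sumVecs-cong : ∀ r {f g : Vec ℕ r → ℕ} → (∀ is → f is ≡ g is) → ∀ N → sumVecs r f N ≡ sumVecs r g N
sumVecs-cong zero f≗g N = f≗g []
sumVecs-cong (suc r) f≗g N = sumBelow-cong (λ x → sumVecs-cong r (λ is → f≗g (x ∷ is)) N) N

sumVecsᶜ : ∀ r {p} {G : Fun (r + p)} → Computable G →
           Computable {suc p} (λ v → sumVecs r (λ is → G (is ++ tail v)) (head v))
sumVecsᶜ zero Gᶜ = Gᶜ ∘ᶜ tailˢ
sumVecsᶜ (suc r) {p} {G} Gᶜ =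
  computable-ext (sumBelowᶜ (inner ∘ᶜ secondᶜ ∷ᶜ headᶜ ∷ᶜ (tailˢ ∘ˢ tailˢ)) ∘ᶜ headᶜ ∷ᶜ idˢ)
    (λ { (N ∷ ys) → sumBelow-cong (λ x → sumVecs-cong r (λ is → reorder-++ is x ys) N) N })
  where
    -- the first coordinate x is moved behind the r summation variables
    G' : Fun (r + suc p)
    G' u = G (head (drop r u) ∷ (take r u ++ tail (drop r u)))
    inner : Computable {suc (suc p)} (λ v → sumVecs r (λ is → G' (is ++ tail v)) (head v))
    inner = sumVecsᶜ r (Gᶜ ∘ᶜ (headᶜ ∘ᶜ dropˢ r) ∷ᶜ ++ˢ (takeˢ r) (tailˢ ∘ˢ dropˢ r))
    reorder-++ : ∀ (is : Vec ℕ r) x ys → G' (is ++ x ∷ ys) ≡ G (x ∷ is ++ ys)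
    reorder-++ is x ys = cong G (cong₂ _∷_ (cong head (drop-++ is (x ∷ ys)))
                                          (cong₂ _++_ (take-++ is (x ∷ ys)) (cong tail (drop-++ is (x ∷ ys)))))

sumVecs-pos⁻ : ∀ r G N → 0 < sumVecs r G N → ∃ λ is → All (_< N) is × 0 < G is
sumVecs-pos⁻ zero G N p = [] , [] , p
sumVecs-pos⁻ (suc r) G N p =
  let x , x<N , q = sumBelow-pos⁻ _ N p
      is , is<N , q' = sumVecs-pos⁻ r (λ is → G (x ∷ is)) N q
  in (x ∷ is) , (x<N ∷ is<N) , q'

sumVecs-pos : ∀ r G N is → All (_< N) is → 0 < G is → 0 < sumVecs r G N
sumVecs-pos zero G N [] [] p = p
sumVecs-pos (suc r) G N (x ∷ is) (x<N ∷ is<N) p =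
  sumBelow-pos _ x x<N (sumVecs-pos r (λ is → G (x ∷ is)) N is is<N p)

-- Relations derived by semidecidable rules

sgn≤1 : ∀ x → sgn x ≤ 1
sgn≤1 zero = z≤n
sgn≤1 (suc x) = s≤s z≤n

sgn-pos : ∀ {x} → 0 < x → 0 < sgn x
sgn-pos {suc x} _ = s≤s z≤n

sgn-pos⁻ : ∀ x → 0 < sgn x → 0 < x
sgn-pos⁻ (suc x) _ = s≤s z≤n

allPositive-pos⁻ : ∀ {m} (v : Vec ℕ m) → 0 < allPositive v → All (0 <_) v
allPositive-pos⁻ [] _ = []
allPositive-pos⁻ (x ∷ v) p = sgn-pos⁻ x (*-posˡ⁻ (sgn x) _ p) ∷ allPositive-pos⁻ v (*-posʳ⁻ (sgn x) _ p)

allPositive-pos : ∀ {m} {v : Vec ℕ m} → All (0 <_) v → 0 < allPositive v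
allPositive-pos [] = s≤s z≤n
allPositive-pos (p ∷ ps) = *-pos (sgn-pos p) (allPositive-pos ps)

map-withˢ : ∀ {p m} {H : Fun (suc p)} {G : Vec ℕ p → Vec ℕ m} → Computable H → Computables G →
            Computables (λ v → map (λ x → H (x ∷ v)) (G v))
map-withˢ {m = zero} {G = G} _ _ = computables-ext []ᶜ (λ v → empty (G v))
  where empty : (w : Vec ℕ 0) {f : ℕ → ℕ} → [] ≡ map f w
        empty [] = refl
map-withˢ {m = suc m} {G = G} Hᶜ Gᶜ =
  computables-ext ((Hᶜ ∘ᶜ (headᶜ ∘ᶜ Gᶜ) ∷ᶜ idˢ) ∷ᶜ map-withˢ {G = λ v → tail (G v)} Hᶜ (tailˢ ∘ˢ Gᶜ))
                  (λ v → sym (map-head∷tail _ (G v)))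

module Derivations {c k r : ℕ} (α β : Fin c → ℕ) (Left Right : Fin k → Vec ℕ (suc r) → Set) where

  data Derivable : ℕ → ℕ → Set where
    base : ∀ j → Derivable (α j) (β j)
    rule : ∀ j {as bs a b} → Pointwise Derivable as bs → Left j (as ∷ʳ a) → Right j (bs ∷ʳ b) → Derivable a b

  module Table (SL : ∀ j → Semidecision (Left j)) (SR : ∀ j → Semidecision (Right j)) where

    baseHit : ℕ → ℕ → ℕ
    baseHit a b = sumFin (λ j → χ≡ a (α j) * χ≡ b (β j))

    ruleHit : ℕ → ℕ → ℕ → Fin k → Vec ℕ r → ℕ
    ruleHit t X i j is = allPositive (map (bit X) is)
                       * stage (SL j) (t ∷ (map (divSuc t) is ∷ʳ divSuc t i))
                       * stage (SR j) (t ∷ (map (modSuc t) is ∷ʳ modSuc t i))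

    next : ℕ → ℕ → ℕ → ℕ
    next t X i = baseHit (divSuc t i) (modSuc t i) + bit X i
               + sumFin (λ j → sumVecs r (ruleHit t X i j) (square t))

    -- Bit (pairIndex t a b) of table t d is set when (a , b) has a derivation of depth below d using only
    -- indices up to t, and rule premises accepted at stage t.
    table : ℕ → ℕ → ℕ
    table t zero = 0
    table t (suc d) = encode (λ i → sgn (next t (table t d) i)) (square t)

    baseHitᶜ : Computable {2} (λ v → baseHit (head v) (head (tail v)))
    baseHitᶜ = sumFinᶜ λ j →
      *ᶜ ∘ᶜ (χ≡ᶜ ∘ᶜ headᶜ ∷ᶜ constᶜ (α j) ∷ᶜ []ᶜ) ∷ᶜ (χ≡ᶜ ∘ᶜ secondᶜ ∷ᶜ constᶜ (β j) ∷ᶜ []ᶜ) ∷ᶜ []ᶜ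

    squareᶜ : Computable {1} (λ v → square (head v))
    squareᶜ = *ᶜ ∘ᶜ (sucᶜ ∘ᶜ headᶜ ∷ᶜ []ᶜ) ∷ᶜ (sucᶜ ∘ᶜ headᶜ ∷ᶜ []ᶜ) ∷ᶜ []ᶜ

    ruleHit++ : Fin k → Fun (r + 3)
    ruleHit++ j w =
      ruleHit (head (tail (tail (drop r w)))) (head (tail (drop r w))) (head (drop r w)) j (take r w)

    ruleHit++ᶜ : ∀ j → Computable (ruleHit++ j)
    ruleHit++ᶜ j =
      *ᶜ ∘ᶜ (*ᶜ ∘ᶜ (allPositiveᶜ ∘ᶜ map-withˢ (bitᶜ ∘ᶜ headᶜ ∷ᶜ (Xᶜ ∘ᶜ tailˢ) ∷ᶜ []ᶜ) (takeˢ r))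
                  ∷ᶜ (stageᶜ (SL j) ∘ᶜ tᶜ ∷ᶜ ∷ʳˢ (map-withˢ (divSucᶜ ∘ᶜ headᶜ ∷ᶜ (tᶜ ∘ᶜ tailˢ) ∷ᶜ []ᶜ) (takeˢ r))
                                                (divSucᶜ ∘ᶜ iᶜ ∷ᶜ tᶜ ∷ᶜ []ᶜ))
                  ∷ᶜ []ᶜ)
            ∷ᶜ (stageᶜ (SR j) ∘ᶜ tᶜ ∷ᶜ ∷ʳˢ (map-withˢ (modSucᶜ ∘ᶜ headᶜ ∷ᶜ (tᶜ ∘ᶜ tailˢ) ∷ᶜ []ᶜ) (takeˢ r))
                                          (modSucᶜ ∘ᶜ iᶜ ∷ᶜ tᶜ ∷ᶜ []ᶜ))
            ∷ᶜ []ᶜ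
      where
        iᶜ : Computable {r + 3} (λ w → head (drop r w))
        iᶜ = headᶜ ∘ᶜ dropˢ r
        Xᶜ : Computable {r + 3} (λ w → head (tail (drop r w)))
        Xᶜ = secondᶜ ∘ᶜ dropˢ r
        tᶜ : Computable {r + 3} (λ w → head (tail (tail (drop r w))))
        tᶜ = thirdᶜ ∘ᶜ dropˢ r

    ruleHit++-++ : ∀ j is i X t → ruleHit++ j (is ++ (i ∷ X ∷ t ∷ [])) ≡ ruleHit t X i j is
    ruleHit++-++ j is i X t rewrite drop-++ is (i ∷ X ∷ t ∷ []) | take-++ is (i ∷ X ∷ t ∷ []) = refl

    nextᶜ : Computable {3} (λ v → next (head (tail (tail v))) (head (tail v)) (head v))
    nextᶜ = computable-ext
      (+ᶜ ∘ᶜ (+ᶜ ∘ᶜ (baseHitᶜ ∘ᶜ (divSucᶜ ∘ᶜ headᶜ ∷ᶜ thirdᶜ ∷ᶜ []ᶜ) ∷ᶜ (modSucᶜ ∘ᶜ headᶜ ∷ᶜ thirdᶜ ∷ᶜ []ᶜ) ∷ᶜ []ᶜ)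
                  ∷ᶜ (bitᶜ ∘ᶜ headᶜ ∷ᶜ secondᶜ ∷ᶜ []ᶜ) ∷ᶜ []ᶜ)
             ∷ᶜ sumFinᶜ (λ j → sumVecsᶜ r (ruleHit++ᶜ j) ∘ᶜ (squareᶜ ∘ᶜ thirdᶜ ∷ᶜ []ᶜ) ∷ᶜ idˢ) ∷ᶜ []ᶜ)
      (λ { (i ∷ X ∷ t ∷ []) → cong (baseHit (divSuc t i) (modSuc t i) + bit X i +_)
                                  (sumFin-cong λ j → sumVecs-cong r (λ is → ruleHit++-++ j is i X t) (square t)) })

    tableᶜ : Computable {2} (λ v → table (head (tail v)) (head v))
    tableᶜ = recursionᶜ _ (constᶜ 0)
      (sumBelowᶜ (*ᶜ ∘ᶜ (sgnᶜ ∘ᶜ nextᶜ ∷ᶜ []ᶜ) ∷ᶜ (2^ᶜ ∘ᶜ headᶜ ∷ᶜ []ᶜ) ∷ᶜ []ᶜ)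
         ∘ᶜ (squareᶜ ∘ᶜ thirdᶜ ∷ᶜ []ᶜ) ∷ᶜ secondᶜ ∷ᶜ thirdᶜ ∷ᶜ []ᶜ)
      (λ { (_ ∷ []) → refl }) (λ { _ (_ ∷ []) → refl })

    bit-table : ∀ t d i → i < square t → bit (table t (suc d)) i ≡ sgn (next t (table t d) i)
    bit-table t d i i< = bit-encode (λ i → sgn (next t (table t d) i)) (square t) i (λ _ → sgn≤1 _) i<

    baseHit-sound : ∀ a b → 0 < baseHit a b → Derivable a b
    baseHit-sound a b p =
      let j , q = sumFin-pos⁻ _ p
      in subst₂ Derivable (sym (χ≡-pos⁻ a (α j) (*-posˡ⁻ (χ≡ a (α j)) _ q)))
                          (sym (χ≡-pos⁻ b (β j) (*-posʳ⁻ (χ≡ a (α j)) _ q))) (base j)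

    table-sound : ∀ t d i → i < square t → 0 < bit (table t d) i → Derivable (divSuc t i) (modSuc t i)
    table-sound t zero i _ p rewrite bit-zero i = ⊥-elim (<-irrefl refl p)
    table-sound t (suc d) i i< p with +-pos⁻ _ _ (sgn-pos⁻ _ (subst (0 <_) (bit-table t d i i<) p))
    ... | inj₁ q with +-pos⁻ _ _ q
    ...   | inj₁ base-hit = baseHit-sound _ _ base-hit
    ...   | inj₂ earlier = table-sound t d i i< earlier
    table-sound t (suc d) i i< p | inj₂ q =
      let j , q₁ = sumFin-pos⁻ _ q
          is , is< , q₂ = sumVecs-pos⁻ r (ruleHit t (table t d) i j) (square t) q₁
          A = allPositive (map (bit (table t d)) is)
          B = stage (SL j) (t ∷ (map (divSuc t) is ∷ʳ divSuc t i))
      in rule j (premises is is< (allPositive-pos⁻ _ (*-posˡ⁻ A B (*-posˡ⁻ (A * B) _ q₂))))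
                (sound (SL j) t _ (*-posʳ⁻ A B (*-posˡ⁻ (A * B) _ q₂)))
                (sound (SR j) t _ (*-posʳ⁻ (A * B) _ q₂))
      where
        premises : ∀ {m} (is : Vec ℕ m) → All (_< square t) is → All (0 <_) (map (bit (table t d)) is) →
                   Pointwise Derivable (map (divSuc t) is) (map (modSuc t) is)
        premises [] [] [] = []
        premises (x ∷ is) (x< ∷ is<) (px ∷ ps) = table-sound t d x x< px ∷ premises is is< ps

    base-enters : ∀ t d i → i < square t → 0 < baseHit (divSuc t i) (modSuc t i) → 0 < bit (table t (suc d)) i
    base-enters t d i i< p = subst (0 <_) (sym (bit-table t d i i<)) (sgn-pos (+-posˡ _ _ (+-posˡ _ _ p)))

    rule-enters : ∀ t d i j is → i < square t → All (_< square t) is → 0 < ruleHit t (table t d) i j is →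
                  0 < bit (table t (suc d)) i
    rule-enters t d i j is i< is< p =
      subst (0 <_) (sym (bit-table t d i i<))
            (sgn-pos (+-posʳ (baseHit (divSuc t i) (modSuc t i) + bit (table t d) i) _
                             (sumFin-pos _ j (sumVecs-pos r _ (square t) is is< p))))

    Stable : ℕ → ℕ → ℕ → Set
    Stable a b t₀ = a ≤ t₀ × b ≤ t₀ × (∀ {t d} → t₀ ≤ t → t₀ < d → 0 < bit (table t d) (pairIndex t a b))

    module StablePairs {t₀ t d} (t₀≤t : t₀ ≤ t) (t₀<d : t₀ < d) where

      decode-pairs : ∀ {m} {as bs : Vec ℕ m} → Pointwise (λ a b → Stable a b t₀) as bs →
                     map (divSuc t) (zipWith (pairIndex t) as bs) ≡ as
                     × map (modSuc t) (zipWith (pairIndex t) as bs) ≡ bs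
      decode-pairs [] = refl , refl
      decode-pairs {as = a ∷ _} {b ∷ _} ((_ , b≤ , _) ∷ stables) =
        let mod≡ , div≡ = pairIndex-decodes t a b (≤-trans b≤ t₀≤t) ; divs≡ , mods≡ = decode-pairs stables
        in cong₂ _∷_ div≡ divs≡ , cong₂ _∷_ mod≡ mods≡

      pairs<square : ∀ {m} {as bs : Vec ℕ m} → Pointwise (λ a b → Stable a b t₀) as bs →
                     All (_< square t) (zipWith (pairIndex t) as bs)
      pairs<square [] = []
      pairs<square ((a≤ , b≤ , _) ∷ stables) =
        pairIndex<square t _ _ (≤-trans a≤ t₀≤t) (≤-trans b≤ t₀≤t) ∷ pairs<square stables

      pairs-present : ∀ {m} {as bs : Vec ℕ m} → Pointwise (λ a b → Stable a b t₀) as bs →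
                      All (0 <_) (map (bit (table t d)) (zipWith (pairIndex t) as bs))
      pairs-present [] = []
      pairs-present ((_ , _ , present) ∷ stables) = present t₀≤t t₀<d ∷ pairs-present stables

    base-stable : ∀ j → Stable (α j) (β j) (α j ⊔ β j)
    base-stable j = m≤m⊔n _ _ , m≤n⊔m _ _ , present
      where
        present : ∀ {t d} → α j ⊔ β j ≤ t → α j ⊔ β j < d → 0 < bit (table t d) (pairIndex t (α j) (β j))
        present {t} {suc d} t₀≤t _ =
          let α≤t = ≤-trans (m≤m⊔n (α j) (β j)) t₀≤t ; β≤t = ≤-trans (m≤n⊔m (α j) (β j)) t₀≤t
              mod≡ , div≡ = pairIndex-decodes t (α j) (β j) β≤t
          in base-enters t d (pairIndex t (α j) (β j)) (pairIndex<square t (α j) (β j) α≤t β≤t)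
               (subst₂ (λ a b → 0 < baseHit a b) (sym div≡) (sym mod≡)
                       (sumFin-pos (λ j' → χ≡ (α j) (α j') * χ≡ (β j) (β j')) j
                                   (*-pos (χ≡-refl (α j)) (χ≡-refl (β j)))))

    rule-stable : ∀ j {t₀ tL tR} {as bs : Vec ℕ r} {a b} → Pointwise (λ a b → Stable a b t₀) as bs →
                  0 < stage (SL j) (tL ∷ (as ∷ʳ a)) → 0 < stage (SR j) (tR ∷ (bs ∷ʳ b)) →
                  Stable a b (suc (t₀ ⊔ tL ⊔ tR ⊔ a ⊔ b))
    rule-stable j {t₀} {tL} {tR} {as} {bs} {a} {b} stables pL pR =
      ≤-trans a≤M (n≤1+n M) , ≤-trans b≤M (n≤1+n M) , present
      where
        M : ℕ
        M = t₀ ⊔ tL ⊔ tR ⊔ a ⊔ b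
        b≤M : b ≤ M
        b≤M = m≤n⊔m (t₀ ⊔ tL ⊔ tR ⊔ a) b
        a≤M : a ≤ M
        a≤M = m≤n⇒m≤n⊔o b (m≤n⊔m (t₀ ⊔ tL ⊔ tR) a)
        tR≤M : tR ≤ M
        tR≤M = m≤n⇒m≤n⊔o b (m≤n⇒m≤n⊔o a (m≤n⊔m (t₀ ⊔ tL) tR))
        tL≤M : tL ≤ M
        tL≤M = m≤n⇒m≤n⊔o b (m≤n⇒m≤n⊔o a (m≤n⇒m≤n⊔o tR (m≤n⊔m t₀ tL)))
        t₀≤M : t₀ ≤ M
        t₀≤M = m≤n⇒m≤n⊔o b (m≤n⇒m≤n⊔o a (m≤n⇒m≤n⊔o tR (m≤m⊔n t₀ tL)))
        present : ∀ {t d} → suc M ≤ t → suc M < d → 0 < bit (table t d) (pairIndex t a b)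
        present {t} {suc d} M<t (s≤s M<d) =
          rule-enters t d (pairIndex t a b) j is (pairIndex<square t a b (≤-trans a≤M M≤t) b≤t)
                      (pairs<square stables) (*-pos (*-pos (allPositive-pos (pairs-present stables)) accL) accR)
          where
            M≤t : M ≤ t
            M≤t = <⇒≤ M<t
            b≤t : b ≤ t
            b≤t = ≤-trans b≤M M≤t
            open StablePairs (≤-trans t₀≤M M≤t) (≤-<-trans t₀≤M M<d)
            is : Vec ℕ r
            is = zipWith (pairIndex t) as bs
            decoded : Decodes t a b
            decoded = pairIndex-decodes t a b b≤t
            accL : 0 < stage (SL j) (t ∷ (map (divSuc t) is ∷ʳ divSuc t (pairIndex t a b)))
            accL = subst₂ (λ u w → 0 < stage (SL j) (t ∷ (u ∷ʳ w))) (sym (proj₁ (decode-pairs stables)))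
                          (sym (proj₂ decoded)) (stage-mono (SL j) _ (≤-trans tL≤M M≤t) pL)
            accR : 0 < stage (SR j) (t ∷ (map (modSuc t) is ∷ʳ modSuc t (pairIndex t a b)))
            accR = subst₂ (λ u w → 0 < stage (SR j) (t ∷ (u ∷ʳ w))) (sym (proj₂ (decode-pairs stables)))
                          (sym (proj₁ decoded)) (stage-mono (SR j) _ (≤-trans tR≤M M≤t) pR)

    stable-mono : ∀ {a b t₀ t₁} → t₀ ≤ t₁ → Stable a b t₀ → Stable a b t₁
    stable-mono t₀≤t₁ (a≤ , b≤ , present) =
      ≤-trans a≤ t₀≤t₁ , ≤-trans b≤ t₀≤t₁ , λ t₁≤t t₁<d → present (≤-trans t₀≤t₁ t₁≤t) (≤-<-trans t₀≤t₁ t₁<d)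

    mutual
      derivable⇒stable : ∀ {a b} → Derivable a b → ∃ (Stable a b)
      derivable⇒stable (base j) = _ , base-stable j
      derivable⇒stable (rule j premises l r) =
        let _ , stables = derivables⇒stable premises
            _ , pL = complete (SL j) _ l
            _ , pR = complete (SR j) _ r
        in _ , rule-stable j stables pL pR

      derivables⇒stable : ∀ {m} {as bs : Vec ℕ m} → Pointwise Derivable as bs →
                          ∃ λ t₀ → Pointwise (λ a b → Stable a b t₀) as bs
      derivables⇒stable [] = 0 , []
      derivables⇒stable (d ∷ ds) =
        let t₁ , s = derivable⇒stable d ; t₂ , ss = derivables⇒stable ds
        in t₁ ⊔ t₂ , stable-mono (m≤m⊔n t₁ t₂) s ∷ Pointwise.map (stable-mono (m≤n⊔m t₁ t₂)) ss

    accepts : ℕ → ℕ → ℕ → ℕ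
    accepts s a b = χ≤ a s * χ≤ b s * bit (table s (suc s)) (pairIndex s a b)

    acceptsᶜ : Computable {3} (λ v → accepts (head v) (head (tail v)) (head (tail (tail v))))
    acceptsᶜ =
      *ᶜ ∘ᶜ (*ᶜ ∘ᶜ (χ≤ᶜ ∘ᶜ secondᶜ ∷ᶜ headᶜ ∷ᶜ []ᶜ) ∷ᶜ (χ≤ᶜ ∘ᶜ thirdᶜ ∷ᶜ headᶜ ∷ᶜ []ᶜ) ∷ᶜ []ᶜ)
         ∷ᶜ (bitᶜ ∘ᶜ (+ᶜ ∘ᶜ (*ᶜ ∘ᶜ secondᶜ ∷ᶜ (sucᶜ ∘ᶜ headᶜ ∷ᶜ []ᶜ) ∷ᶜ []ᶜ) ∷ᶜ thirdᶜ ∷ᶜ []ᶜ)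
                   ∷ᶜ (tableᶜ ∘ᶜ (sucᶜ ∘ᶜ headᶜ ∷ᶜ []ᶜ) ∷ᶜ headᶜ ∷ᶜ []ᶜ) ∷ᶜ []ᶜ)
         ∷ᶜ []ᶜ

    accepts-sound : ∀ s a b → 0 < accepts s a b → Derivable a b
    accepts-sound s a b p =
      let χa = χ≤ a s ; χb = χ≤ b s ; bounds = *-posˡ⁻ (χa * χb) _ p
          a≤s = χ≤-pos⁻ a s (*-posˡ⁻ χa χb bounds) ; b≤s = χ≤-pos⁻ b s (*-posʳ⁻ χa χb bounds)
          mod≡ , div≡ = pairIndex-decodes s a b b≤s
      in subst₂ Derivable div≡ mod≡
                (table-sound s (suc s) _ (pairIndex<square s a b a≤s b≤s) (*-posʳ⁻ (χa * χb) _ p))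

    accepts-complete : ∀ {a b} → Derivable a b → ∃ λ s → 0 < accepts s a b
    accepts-complete d =
      let s , a≤s , b≤s , present = derivable⇒stable d
      in s , *-pos (*-pos (χ≤-pos a≤s) (χ≤-pos b≤s)) (present ≤-refl ≤-refl)

    derivable-sd : Semidecision (λ v → Derivable (head v) (head (tail v)))
    derivable-sd = sd-⇔ (sd-∃ (sd-positive acceptsᶜ))
                        (λ { (a ∷ b ∷ []) (s , p) → accepts-sound s a b p })
                        (λ { (a ∷ b ∷ []) d → accepts-complete d })

-- Matching two presentations

matching⇒equivalent : ∀ {L} (𝔐 : Structure L) {ρ γ : ℕ → Structure.Carrier 𝔐} → (∀ m → ∃ λ n → ρ n ≡ m) →
                      Semidecision {2} (λ v → ρ (head v) ≡ γ (head (tail v))) → Equivalent 𝔐 ρ γ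
matching⇒equivalent 𝔐 {ρ} {γ} ρ-onto S =
  let φ , (e , evaluates) , matches = sd-choice S (λ { (n ∷ []) → ρ-onto (γ n) })
  in (λ n → φ (n ∷ [])) , (e , λ n → evaluates (n ∷ [])) , λ n → sym (matches (n ∷ []))

module Generation {L : Language} (𝔐 : Structure L) {c k r : ℕ} (g : Fin c → Structure.Carrier 𝔐)
                  (F : Fin k → Vec (Structure.Carrier 𝔐) r → Structure.Carrier 𝔐)
                  {ρ γ : ℕ → Structure.Carrier 𝔐}
                  (Pρ : IsListablePresentation 𝔐 ρ) (Pγ : IsListablePresentation 𝔐 γ) where
  open Structure 𝔐
  open IsListablePresentation using (surjective)

  open Derivations (λ j → proj₁ (surjective Pρ (g j))) (λ j → proj₁ (surjective Pγ (g j)))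
                   (λ i ns → GraphOf (F i) (map ρ ns)) (λ i ns → GraphOf (F i) (map γ ns))

  mutual
    derivable⇒matching : ∀ {a b} → Derivable a b → ρ a ≡ γ b
    derivable⇒matching (base j) = trans (proj₂ (surjective Pρ (g j))) (sym (proj₂ (surjective Pγ (g j))))
    derivable⇒matching (rule i {as} {bs} {a} {b} premises l r) =
      trans (sym (GraphOf-map⁻ (F i) ρ as a l))
            (trans (cong (F i) (derivables⇒matching premises)) (GraphOf-map⁻ (F i) γ bs b r))

    derivables⇒matching : ∀ {m} {as bs : Vec ℕ m} → Pointwise Derivable as bs → map ρ as ≡ map γ bs
    derivables⇒matching [] = refl
    derivables⇒matching (d ∷ ds) = cong₂ _∷_ (derivable⇒matching d) (derivables⇒matching ds)

  mutual
    generated⇒derivable : ∀ {m} → Generated 𝔐 g F m → Σ ℕ λ a → Σ ℕ λ b → ρ a ≡ m × γ b ≡ m × Derivable a b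
    generated⇒derivable (gen-base j) =
      _ , _ , proj₂ (surjective Pρ (g j)) , proj₂ (surjective Pγ (g j)) , base j
    generated⇒derivable (gen-app i xs generated) =
      let as , bs , ρas , γbs , premises = all-generated⇒derivable generated
          a , ρa = surjective Pρ (F i xs)
          b , γb = surjective Pγ (F i xs)
      in a , b , ρa , γb
           , rule i premises (GraphOf-map (F i) ρ as a (trans (cong (F i) ρas) (sym ρa)))
                             (GraphOf-map (F i) γ bs b (trans (cong (F i) γbs) (sym γb)))

    all-generated⇒derivable : ∀ {m} {xs : Vec Carrier m} → All (Generated 𝔐 g F) xs →
      Σ (Vec ℕ m) λ as → Σ (Vec ℕ m) λ bs → map ρ as ≡ xs × map γ bs ≡ xs × Pointwise Derivable as bs
    all-generated⇒derivable [] = [] , [] , refl , refl , []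
    all-generated⇒derivable (x ∷ xs) =
      let a , b , ρa , γb , d = generated⇒derivable x
          as , bs , ρas , γbs , ds = all-generated⇒derivable xs
      in (a ∷ as) , (b ∷ bs) , cong₂ _∷_ ρa ρas , cong₂ _∷_ γb γbs , d ∷ ds

  matching-sd : (∀ i → PEDefinableFunction 𝔐 (F i)) → (∀ m → Generated 𝔐 g F m) →
                Semidecision {2} (λ v → ρ (head v) ≡ γ (head (tail v)))
  matching-sd F-definable generated =
    sd-⇔ (sd-∃ⁿ 2 (sd-∧ ρ-equal (sd-∧ derivable γ-equal)))
         (λ { (a ∷ b ∷ []) ((a' ∷ b' ∷ []) , ρa≡ρa' , d , γb'≡γb) →
                trans ρa≡ρa' (trans (derivable⇒matching d) γb'≡γb) })
         (λ { (a ∷ b ∷ []) ρa≡γb → let a' , b' , ρa' , γb' , d = generated⇒derivable (generated (ρ a)) in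
                (a' ∷ b' ∷ []) , sym ρa' , d , trans γb' ρa≡γb })
    where
      open Presentation 𝔐 using (≡-sd; pe-definable-sd)
      fourthᶜ : ∀ {n} → Computable {suc (suc (suc (suc n)))} (λ v → head (tail (tail (tail v))))
      fourthᶜ = computable-ext (projᶜ (suc (suc (suc zero)))) (λ { (_ ∷ _ ∷ _ ∷ _ ∷ _) → refl })
      ρ-equal : Semidecision {4} (λ v → ρ (head (tail (tail v))) ≡ ρ (head v))
      ρ-equal = sd-∘ (λ v → head (tail (tail v)) ∷ head v ∷ []) (thirdᶜ ∷ᶜ headᶜ ∷ᶜ []ᶜ) (≡-sd Pρ)
      derivable : Semidecision {4} (λ v → Derivable (head v) (head (tail v)))
      derivable = sd-∘ (λ v → head v ∷ head (tail v) ∷ []) (headᶜ ∷ᶜ secondᶜ ∷ᶜ []ᶜ)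
                       (Table.derivable-sd (λ i → pe-definable-sd Pρ (F-definable i))
                                           (λ i → pe-definable-sd Pγ (F-definable i)))
      γ-equal : Semidecision {4} (λ v → γ (head (tail v)) ≡ γ (head (tail (tail (tail v)))))
      γ-equal = sd-∘ (λ v → head (tail v) ∷ head (tail (tail (tail v))) ∷ []) (secondᶜ ∷ᶜ fourthᶜ ∷ᶜ []ᶜ)
                     (≡-sd Pγ)

proposition3p33 : (L : Language) (𝔐 : Structure L) →
    IsListable 𝔐 →
    (c k r : ℕ) (g : Fin (suc c) → Structure.Carrier 𝔐)
    (F : Fin k → Vec (Structure.Carrier 𝔐) r → Structure.Carrier 𝔐) →
    (∀ j → PEDefinableElement 𝔐 (g j)) →
    (∀ i → PEDefinableFunction 𝔐 (F i)) →
    (∀ m → Generated 𝔐 g F m) →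
    UniquelyListable 𝔐
proposition3p33 L 𝔐 _ c k r g F _ F-definable generated ρ γ Pρ Pγ =
  matching⇒equivalent 𝔐 (IsListablePresentation.surjective Pρ)
                        (Generation.matching-sd 𝔐 g F Pρ Pγ F-definable generated)
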